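{- Let $\phi$ be an instance of monotone 1-in-3 SAT with variables $x_1,\dots,x_n$ and clauses $C_1,\dots,C_m$, and let $G=(A\cup P,E)$ be the instance constructed from $\phi$ as described in the context. Then $G$ admits a matching that is popular among all feasible matchings if and only if $\phi$ has a satisfying 1-in-3 assignment (an assignment making exactly one variable of each clause true).
   Context: Monotone 1-in-3 SAT: each clause is a disjunction of exactly three distinct unnegated variables. Construction of $G$: applicants $A=\{a_i,b_i: 1\le i\le n\}\cup\{a_{ij},b_{ij}: x_i\in C_j\}$; posts $P=\{p_i,p^t_i,p^f_i:1\le i\le n\}\cup\{p_j: 1\le j\le m\}$ (clause posts $p_j$ distinct from variable posts $p_i$). Strict preference lists (first entry rank 1, second rank 2): $a_i: p_i, p^t_i$; $b_i: p_i, p^f_i$; $a_{ij}: p_j, p^t_i$; $b_{ij}: p_j,p^f_i$. Each applicant can be matched to at most one post. For a clause $C_j=x_i\vee x_{i'}\vee x_{i''}$, post $p_j$ has quota 3 and classes $\{a_{ij},b_{ij}\}$ with quota 1 for each variable $x_i$ of $C_j$, $\{a_{ij},a_{i'j},a_{i''j}\}$ with quota 1, and $\{b_{ij},b_{i'j},b_{i''j}\}$ with quota 2. With $k_i$ the number of occurrences of $x_i$ in $\phi$: $p^t_i$ has quota $k_i$ and classes $\{a_{ij},a_i\}$ with quota 1 for each $j$ with $x_i\in C_j$; $p^f_i$ has quota $k_i$ and classes $\{b_{ij},b_i\}$ with quota 1 for each $j$ with $x_i\in C_j$; $p_i$ has quota 1 and no classes. A matching $M\subseteq E$ is feasible if every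 post $p$ has $|M(p)|\le q(p)$ and $|M(p)\cap C|\le q(C)$ for each class $C$ of $p$. For feasible $M,M'$, applicant $a$ prefers $M$ to $M'$ if it ranks $M(a)$ strictly better than $M'(a)$ (being matched beats being unmatched); $M$ is more popular than $M'$ if more applicants prefer $M$ to $M'$ than vice versa; a feasible $M$ is popular among feasible matchings if no feasible matching is more popular than $M$. -}

module Defs where

open import Data.Nat using (ℕ; zero; suc; _+_; _≤_; _<_)
open import Data.Fin using (Fin; zero; suc) renaming (_≟_ to _≟F_; _<?_ to _<?F_)
open import Data.Bool using (Bool; true; false; if_then_else_)
open import Data.List using (List; []; _∷_; _++_; map; concatMap; allFin; filterᵇ)
open import Data.List.Relation.Unary.All using (All)
open import Data.Maybe using (Maybe; just; nothing; maybe)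
open import Data.Product using (_×_; _,_; proj₁; proj₂)
open import Relation.Nullary using (¬_)
open import Relation.Nullary.Decidable using (⌊_⌋)
open import Relation.Binary.PropositionalEquality using (_≡_)

-- Applicants of G.  For clause C_j (j : Fin m) whose k-th variable (k : Fin 3)
-- is x_i, the applicant a_{ij} is  ac j k  and b_{ij} is  bc j k.
data Applicant (n m : ℕ) : Set where
  a b   : Fin n → Applicant n m
  ac bc : Fin m → Fin 3 → Applicant n m

-- Posts of G: pv i = p_i, pt i = p^t_i, pf i = p^f_i, pc j = clause post p_j.
data Post (n m : ℕ) : Set where
  pv pt pf : Fin n → Post n m
  pc       : Fin m → Post n m

countB : {A : Set} → (A → Bool) → List A → ℕ
countB f []       = 0
countB f (x ∷ xs) = (if f x then 1 else 0) + countB f xs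

postEq : {n m : ℕ} → Post n m → Post n m → Bool
postEq (pv i) (pv i') = ⌊ i ≟F i' ⌋
postEq (pt i) (pt i') = ⌊ i ≟F i' ⌋
postEq (pf i) (pf i') = ⌊ i ≟F i' ⌋
postEq (pc j) (pc j') = ⌊ j ≟F j' ⌋
postEq _      _       = false

-- An instance of monotone 1-in-3 SAT with variables x_0..x_{n-1} and clauses
-- C_0..C_{m-1}; cl j k is the k-th variable of clause C_j.
-- The three variables of every clause are distinct:
DistinctVars : {n m : ℕ} → (Fin m → Fin 3 → Fin n) → Set
DistinctVars {n} {m} cl = ∀ (j : Fin m) (k k' : Fin 3) → cl j k ≡ cl j k' → k ≡ k'

module Construction {n m : ℕ} (cl : Fin m → Fin 3 → Fin n) where

  -- preference lists: pref x zero = rank-1 post, pref x (suc zero) = rank-2 post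
  pref : Applicant n m → Fin 2 → Post n m
  pref (a i)    zero       = pv i
  pref (a i)    (suc zero) = pt i
  pref (b i)    zero       = pv i
  pref (b i)    (suc zero) = pf i
  pref (ac j k) zero       = pc j
  pref (ac j k) (suc zero) = pt (cl j k)
  pref (bc j k) zero       = pc j
  pref (bc j k) (suc zero) = pf (cl j k)

  slots : List (Fin m × Fin 3)
  slots = concatMap (λ j → map (λ k → (j , k)) (allFin 3)) (allFin m)

  occursAs : Fin n → Fin m × Fin 3 → Bool
  occursAs i (j , k) = ⌊ cl j k ≟F i ⌋

  allApplicants : List (Applicant n m)
  allApplicants = map a (allFin n) ++ map b (allFin n)
               ++ map (λ s → ac (proj₁ s) (proj₂ s)) slots
               ++ map (λ s → bc (proj₁ s) (proj₂ s)) slots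

  occ : Fin n → ℕ
  occ i = countB (occursAs i) slots

  quota : Post n m → ℕ
  quota (pv i) = 1
  quota (pt i) = occ i
  quota (pf i) = occ i
  quota (pc j) = 3

  -- a class: its members and its quota
  Class : Set
  Class = List (Applicant n m) × ℕ

  classes : Post n m → List Class
  classes (pv i) = []
  classes (pt i) = map (λ s → (ac (proj₁ s) (proj₂ s) ∷ a i ∷ [] , 1)) (filterᵇ (occursAs i) slots)
  classes (pf i) = map (λ s → (bc (proj₁ s) (proj₂ s) ∷ b i ∷ [] , 1)) (filterᵇ (occursAs i) slots)
  classes (pc j) = map (λ k → (ac j k ∷ bc j k ∷ [] , 1)) (allFin 3)
                ++ ((map (ac j) (allFin 3) , 1) ∷ (map (bc j) (allFin 3) , 2) ∷ [])

  -- A matching M ⊆ E in which each applicant has at most one post: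
  -- M x = nothing (unmatched) or just r (matched to the post of rank r+1 in x's list).
  Matching : Set
  Matching = Applicant n m → Maybe (Fin 2)

  matchedTo : Matching → Post n m → Applicant n m → Bool
  matchedTo M p x = maybe (λ r → postEq (pref x r) p) false (M x)

  load : Matching → Post n m → List (Applicant n m) → ℕ
  load M p C = countB (matchedTo M p) C

  Feasible : Matching → Set
  Feasible M = ∀ (p : Post n m) →
    (load M p allApplicants ≤ quota p)
    × All (λ c → load M p (proj₁ c) ≤ proj₂ c) (classes p)

  better : Maybe (Fin 2) → Maybe (Fin 2) → Bool
  better (just r) nothing   = true
  better (just r) (just r') = ⌊ r <?F r' ⌋
  better nothing  _         = false

  votes : Matching → Matching → ℕ
  votes M M' = countB (λ x → better (M x) (M' x)) allApplicants

  MorePopular : Matching → Matching → Set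
  MorePopular M M' = votes M' M < votes M M'

  PopularAmongFeasible : Matching → Set
  PopularAmongFeasible M = Feasible M × (∀ (M' : Matching) → Feasible M' → ¬ MorePopular M' M)

  OneInThree : (Fin n → Bool) → Set
  OneInThree σ = ∀ (j : Fin m) → countB (λ k → σ (cl j k)) (allFin 3) ≡ 1

module Submission where

-- The argument rests on the partner involution a_i ↔ b_i, a_{ij} ↔ b_{ij}: if every applicant who
-- prefers N to N' has a partner preferring N' to N, then N' gets at least as many votes as N, and
-- strictly more if in addition some partner gains at no cost.
--
-- Reading x_i
--     as true when a_i holds p^t_i then gives exactly one true variable per clause.

open import Defs
open import Data.Nat using (ℕ; zero; suc; _+_; _≤_; _<_; z≤n; s≤s)
open import Data.Nat.Properties
open import Data.Fin using (Fin; zero; suc) renaming (_≟_ to _≟F_)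
open import Data.Bool using (Bool; true; false; if_then_else_; _∧_; _∨_)
import Data.Bool
open import Data.Bool.Properties using (∨-zeroʳ; ¬-not; T?)
open import Data.Maybe using (Maybe; just; nothing)
open import Data.List using (List; []; _∷_; _++_; map; concat; tabulate; allFin)
open import Data.List.Properties using (map-tabulate)
open import Data.List.Membership.Propositional using (_∈_)
open import Data.List.Membership.Propositional.Properties using (∈-map⁺; ∈-++⁺ˡ; ∈-++⁺ʳ; ∈-allFin; ∈-concatMap⁺; ∈-filter⁺)
open import Data.List.Relation.Unary.Any using (here; there)
import Data.List.Relation.Unary.Any as Any
open import Data.List.Relation.Unary.All using (All; []; _∷_)
import Data.List.Relation.Unary.All as All
open import Data.List.Relation.Unary.All.Properties using (map⁺; map⁻)
open import Data.Product using (_×_; _,_; proj₁; proj₂; ∃)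
open import Data.Sum using (_⊎_; inj₁; inj₂)
open import Data.Empty using (⊥; ⊥-elim)
open import Data.Fin.Properties using () renaming (suc-injective to fin-suc-injective)
open import Function using (_∘_; id)
open import Function.Bundles using (_⇔_; mk⇔)
open import Relation.Nullary using (¬_; yes; no; Dec)
open import Relation.Nullary.Decidable using (⌊_⌋; isYes≗does; dec-true; dec-false; toWitness)
open import Relation.Binary.PropositionalEquality using (_≡_; _≢_; refl; sym; trans; cong; cong₂; subst; subst₂)
open Relation.Binary.PropositionalEquality.≡-Reasoning

𝟙 : Bool → ℕ
𝟙 β = if β then 1 else 0

𝟙≤1 : (β : Bool) → 𝟙 β ≤ 1
𝟙≤1 true  = ≤-refl
𝟙≤1 false = z≤n

module _ {A : Set} where

  countB-++ : (f : A → Bool) (xs ys : List A) → countB f (xs ++ ys) ≡ countB f xs + countB f ys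
  countB-++ f []       ys = refl
  countB-++ f (x ∷ xs) ys = trans (cong (𝟙 (f x) +_) (countB-++ f xs ys)) (sym (+-assoc (𝟙 (f x)) _ _))

  countB-cong : {f g : A → Bool} → (∀ x → f x ≡ g x) → (xs : List A) → countB f xs ≡ countB g xs
  countB-cong f≡g []       = refl
  countB-cong f≡g (x ∷ xs) rewrite f≡g x = cong (𝟙 _ +_) (countB-cong f≡g xs)

  countB-mono : {f g : A → Bool} → (∀ x → f x ≡ true → g x ≡ true) → (xs : List A) → countB f xs ≤ countB g xs
  countB-mono f⇒g [] = z≤n
  countB-mono {f} {g} f⇒g (x ∷ xs) with f x in fx | g x in gx
  ... | true  | true  = s≤s (countB-mono f⇒g xs)
  ... | true  | false with () ← trans (sym (f⇒g x fx)) gx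
  ... | false | true  = m≤n⇒m≤1+n (countB-mono f⇒g xs)
  ... | false | false = countB-mono f⇒g xs

  countB-mono-< : {f g : A → Bool} → (∀ x → f x ≡ true → g x ≡ true) → (xs : List A) →
    (x₀ : A) → x₀ ∈ xs → f x₀ ≡ false → g x₀ ≡ true → countB f xs < countB g xs
  countB-mono-< f⇒g (x ∷ xs) x₀ (here refl) fx₀ gx₀ rewrite fx₀ | gx₀ = s≤s (countB-mono f⇒g xs)
  countB-mono-< {f} {g} f⇒g (x ∷ xs) x₀ (there x₀∈) fx₀ gx₀ with f x in fx | g x in gx
  ... | true  | true  = s≤s (countB-mono-< f⇒g xs x₀ x₀∈ fx₀ gx₀)
  ... | true  | false with () ← trans (sym (f⇒g x fx)) gx
  ... | false | true  = m≤n⇒m≤1+n (countB-mono-< f⇒g xs x₀ x₀∈ fx₀ gx₀)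
  ... | false | false = countB-mono-< f⇒g xs x₀ x₀∈ fx₀ gx₀

  countB-none : (f : A → Bool) → (xs : List A) → (∀ x → x ∈ xs → f x ≡ false) → countB f xs ≡ 0
  countB-none f []       none = refl
  countB-none f (x ∷ xs) none rewrite none x (here refl) = countB-none f xs (λ y y∈ → none y (there y∈))

  countB-positive : (f : A → Bool) (xs : List A) (x : A) → x ∈ xs → f x ≡ true → 1 ≤ countB f xs
  countB-positive f (y ∷ xs) x (here refl) fx rewrite fx = s≤s z≤n
  countB-positive f (y ∷ xs) x (there x∈) fx = ≤-trans (countB-positive f xs x x∈ fx) (m≤n+m _ (𝟙 (f y)))

  countB-concat-single : ∀ {n} (f : A → Bool) (G : Fin n → List A) (i : Fin n) →
    (∀ i' → i' ≢ i → countB f (G i') ≡ 0) → countB f (concat (tabulate G)) ≡ countB f (G i)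
  countB-concat-single {suc n} f G zero elsewhere = begin
      countB f (G zero ++ concat (tabulate (G ∘ suc)))
        ≡⟨ countB-++ f (G zero) _ ⟩
      countB f (G zero) + countB f (concat (tabulate (G ∘ suc)))
        ≡⟨ cong (countB f (G zero) +_) (countB-concat-none (G ∘ suc) (λ i' → elsewhere (suc i') (λ ()))) ⟩
      countB f (G zero) + 0
        ≡⟨ +-identityʳ _ ⟩
      countB f (G zero) ∎
    where
      countB-concat-none : ∀ {k} (H : Fin k → List A) → (∀ i' → countB f (H i') ≡ 0) → countB f (concat (tabulate H)) ≡ 0
      countB-concat-none {zero}  H none = refl
      countB-concat-none {suc k} H none rewrite countB-++ f (H zero) (concat (tabulate (H ∘ suc))) | none zero =
        countB-concat-none (H ∘ suc) (none ∘ suc)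
  countB-concat-single {suc n} f G (suc i) elsewhere
    rewrite countB-++ f (G zero) (concat (tabulate (G ∘ suc))) | elsewhere zero (λ ()) =
    countB-concat-single f (G ∘ suc) i (λ i' i'≢i → elsewhere (suc i') (λ e → i'≢i (fin-suc-injective e)))

module _ (u : Fin 3 → Bool) where

  AtMostOne : Set
  AtMostOne = ∀ k k' → u k ≡ true → u k' ≡ true → k ≡ k'

  NotAllThree : Set
  NotAllThree = u zero ≡ true → u (suc zero) ≡ true → u (suc (suc zero)) ≡ true → ⊥

  two-true⇒count≥2 : ∀ k k' → k ≢ k' → u k ≡ true → u k' ≡ true → 2 ≤ countB u (allFin 3)
  two-true⇒count≥2 zero zero k≢k' = ⊥-elim (k≢k' refl)
  two-true⇒count≥2 (suc zero) (suc zero) k≢k' = ⊥-elim (k≢k' refl)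
  two-true⇒count≥2 (suc (suc zero)) (suc (suc zero)) k≢k' = ⊥-elim (k≢k' refl)
  two-true⇒count≥2 zero (suc zero) _ u₀ u₁ rewrite u₀ | u₁ = s≤s (s≤s z≤n)
  two-true⇒count≥2 (suc zero) zero _ u₁ u₀ rewrite u₀ | u₁ = s≤s (s≤s z≤n)
  two-true⇒count≥2 zero (suc (suc zero)) _ u₀ u₂ rewrite u₀ | u₂ = s≤s (m≤n+m 1 (𝟙 (u (suc zero))))
  two-true⇒count≥2 (suc (suc zero)) zero _ u₂ u₀ rewrite u₀ | u₂ = s≤s (m≤n+m 1 (𝟙 (u (suc zero))))
  two-true⇒count≥2 (suc zero) (suc (suc zero)) _ u₁ u₂ rewrite u₁ | u₂ = m≤n+m 2 (𝟙 (u zero))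
  two-true⇒count≥2 (suc (suc zero)) (suc zero) _ u₂ u₁ rewrite u₁ | u₂ = m≤n+m 2 (𝟙 (u zero))

  count≤1⇒atMostOne : countB u (allFin 3) ≤ 1 → AtMostOne
  count≤1⇒atMostOne bound k k' uk uk' with k ≟F k'
  ... | yes k≡k' = k≡k'
  ... | no  k≢k' = ⊥-elim (<⇒≱ (two-true⇒count≥2 k k' k≢k' uk uk') bound)

  atMostOne⇒count≤1 : AtMostOne → countB u (allFin 3) ≤ 1
  atMostOne⇒count≤1 uniq with u zero in u₀ | u (suc zero) in u₁ | u (suc (suc zero)) in u₂
  ... | true  | true  | _     with () ← uniq zero (suc zero) u₀ u₁
  ... | true  | false | true  with () ← uniq zero (suc (suc zero)) u₀ u₂
  ... | false | true  | true  with () ← uniq (suc zero) (suc (suc zero)) u₁ u₂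
  ... | true  | false | false = ≤-refl
  ... | false | true  | false = ≤-refl
  ... | false | false | true  = ≤-refl
  ... | false | false | false = z≤n

  exactlyOne : AtMostOne → (k : Fin 3) → u k ≡ true → countB u (allFin 3) ≡ 1
  exactlyOne uniq k uk = ≤-antisym (atMostOne⇒count≤1 uniq) (countB-positive u (allFin 3) k (∈-allFin k) uk)

  count≤2⇒notAllThree : countB u (allFin 3) ≤ 2 → NotAllThree
  count≤2⇒notAllThree bound u₀ u₁ u₂ rewrite u₀ | u₁ | u₂ with bound
  ... | s≤s (s≤s ())

  notAllThree⇒count≤2 : NotAllThree → countB u (allFin 3) ≤ 2
  notAllThree⇒count≤2 notAll with u zero | u (suc zero) | u (suc (suc zero))
  ... | true  | true  | true  = ⊥-elim (notAll refl refl refl)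
  ... | false | y     | z     = +-mono-≤ (𝟙≤1 y) (+-mono-≤ (𝟙≤1 z) z≤n)
  ... | true  | false | z     = s≤s (+-mono-≤ (𝟙≤1 z) z≤n)
  ... | true  | true  | false = ≤-refl

pair≤1⇒disjoint : (x y : Bool) → 𝟙 x + (𝟙 y + 0) ≤ 1 → x ≡ true → y ≡ true → ⊥
pair≤1⇒disjoint true true (s≤s ()) refl refl

disjoint⇒pair≤1 : (x y : Bool) → (x ≡ true → y ≡ true → ⊥) → 𝟙 x + (𝟙 y + 0) ≤ 1
disjoint⇒pair≤1 true  true  disj = ⊥-elim (disj refl refl)
disjoint⇒pair≤1 true  false _ = ≤-refl
disjoint⇒pair≤1 false true  _ = ≤-refl
disjoint⇒pair≤1 false false _ = z≤n

prev next : Fin 3 → Fin 3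
prev zero             = suc (suc zero)
prev (suc zero)       = zero
prev (suc (suc zero)) = suc zero
next zero             = suc zero
next (suc zero)       = suc (suc zero)
next (suc (suc zero)) = zero

prev-≢ : ∀ k → prev k ≢ k
prev-≢ zero             ()
prev-≢ (suc zero)       ()
prev-≢ (suc (suc zero)) ()

prev-next : ∀ k → prev (next k) ≡ k
prev-next zero             = refl
prev-next (suc zero)       = refl
prev-next (suc (suc zero)) = refl

next-prev : ∀ k → next (prev k) ≡ k
next-prev zero             = refl
next-prev (suc zero)       = refl
next-prev (suc (suc zero)) = refl

prev-injective : ∀ {k k'} → prev k ≡ prev k' → k ≡ k'
prev-injective {k} {k'} e = trans (sym (next-prev k)) (trans (cong next e) (next-prev k'))

clash : ∀ {β} → β ≡ true → β ≡ false → ⊥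
clash refl ()

some : (Fin 3 → Bool) → Bool
some u = u zero ∨ (u (suc zero) ∨ u (suc (suc zero)))

some-sound : ∀ u → some u ≡ true → ∃ λ k → u k ≡ true
some-sound u e with u zero in u₀ | u (suc zero) in u₁ | u (suc (suc zero)) in u₂
... | true  | _     | _    = zero , u₀
... | false | true  | _    = suc zero , u₁
... | false | false | true = suc (suc zero) , u₂
some-sound u () | false | false | false

some-complete : ∀ u k → u k ≡ true → some u ≡ true
some-complete u zero             e rewrite e = refl
some-complete u (suc zero)       e rewrite e = ∨-zeroʳ (u zero)
some-complete u (suc (suc zero)) e rewrite e | ∨-zeroʳ (u (suc zero)) = ∨-zeroʳ (u zero)

∧-split : ∀ {x y} → x ∧ y ≡ true → x ≡ true × y ≡ true
∧-split {true} e = refl , e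

≟-refl : ∀ {k} (i : Fin k) → ⌊ i ≟F i ⌋ ≡ true
≟-refl i = trans (isYes≗does (i ≟F i)) (dec-true (i ≟F i) refl)

≟-≢ : ∀ {k} {i j : Fin k} → i ≢ j → ⌊ i ≟F j ⌋ ≡ false
≟-≢ {i = i} {j} i≢j = trans (isYes≗does (i ≟F j)) (dec-false (i ≟F j) i≢j)

≟-sound : ∀ {k} {i j : Fin k} → ⌊ i ≟F j ⌋ ≡ true → i ≡ j
≟-sound {i = i} {j} e = toWitness (subst Data.Bool.T (sym e) _)

pattern first  = just zero
pattern second = just (suc zero)

first? : (r : Maybe (Fin 2)) → r ≡ first ⊎ r ≢ first
first? first   = inj₁ refl
first? second  = inj₂ λ ()
first? nothing = inj₂ λ ()

isFirst isSecond : Maybe (Fin 2) → Bool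
isFirst first    = true
isFirst _        = false
isSecond second  = true
isSecond _       = false

isFirst-sound : ∀ r → isFirst r ≡ true → r ≡ first
isFirst-sound first _ = refl

isFirst-≢ : ∀ {r} → r ≢ first → isFirst r ≡ false
isFirst-≢ {first}   r≢first = ⊥-elim (r≢first refl)
isFirst-≢ {second}  _ = refl
isFirst-≢ {nothing} _ = refl

module Reduction {n m : ℕ} (cl : Fin m → Fin 3 → Fin n) where
  open Construction cl

  postEq-sound : (p q : Post n m) → postEq p q ≡ true → p ≡ q
  postEq-sound (pv i) (pv j) e = cong pv (≟-sound e)
  postEq-sound (pt i) (pt j) e = cong pt (≟-sound e)
  postEq-sound (pf i) (pf j) e = cong pf (≟-sound e)
  postEq-sound (pc i) (pc j) e = cong pc (≟-sound e)
  postEq-sound (pv _) (pt _) ()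
  postEq-sound (pv _) (pf _) ()
  postEq-sound (pv _) (pc _) ()
  postEq-sound (pt _) (pv _) ()
  postEq-sound (pt _) (pf _) ()
  postEq-sound (pt _) (pc _) ()
  postEq-sound (pf _) (pv _) ()
  postEq-sound (pf _) (pt _) ()
  postEq-sound (pf _) (pc _) ()
  postEq-sound (pc _) (pv _) ()
  postEq-sound (pc _) (pt _) ()
  postEq-sound (pc _) (pf _) ()

  postEq-refl : (p : Post n m) → postEq p p ≡ true
  postEq-refl (pv i) = ≟-refl i
  postEq-refl (pt i) = ≟-refl i
  postEq-refl (pf i) = ≟-refl i
  postEq-refl (pc j) = ≟-refl j

  data Holds (M : Matching) : Applicant n m → Post n m → Set where
    a↦p   : ∀ {i}   → M (a i) ≡ first     → Holds M (a i) (pv i)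
    a↦pᵗ  : ∀ {i}   → M (a i) ≡ second    → Holds M (a i) (pt i)
    b↦p   : ∀ {i}   → M (b i) ≡ first     → Holds M (b i) (pv i)
    b↦pᶠ  : ∀ {i}   → M (b i) ≡ second    → Holds M (b i) (pf i)
    ac↦p  : ∀ {j k} → M (ac j k) ≡ first  → Holds M (ac j k) (pc j)
    ac↦pᵗ : ∀ {j k} → M (ac j k) ≡ second → Holds M (ac j k) (pt (cl j k))
    bc↦p  : ∀ {j k} → M (bc j k) ≡ first  → Holds M (bc j k) (pc j)
    bc↦pᶠ : ∀ {j k} → M (bc j k) ≡ second → Holds M (bc j k) (pf (cl j k))

  holds : ∀ M x p → matchedTo M p x ≡ true → Holds M x p
  holds M x p e with M x in Mx
  holds M (a i)    p e | first  = subst (Holds M (a i))    (postEq-sound _ p e) (a↦p Mx)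
  holds M (a i)    p e | second = subst (Holds M (a i))    (postEq-sound _ p e) (a↦pᵗ Mx)
  holds M (b i)    p e | first  = subst (Holds M (b i))    (postEq-sound _ p e) (b↦p Mx)
  holds M (b i)    p e | second = subst (Holds M (b i))    (postEq-sound _ p e) (b↦pᶠ Mx)
  holds M (ac j k) p e | first  = subst (Holds M (ac j k)) (postEq-sound _ p e) (ac↦p Mx)
  holds M (ac j k) p e | second = subst (Holds M (ac j k)) (postEq-sound _ p e) (ac↦pᵗ Mx)
  holds M (bc j k) p e | first  = subst (Holds M (bc j k)) (postEq-sound _ p e) (bc↦p Mx)
  holds M (bc j k) p e | second = subst (Holds M (bc j k)) (postEq-sound _ p e) (bc↦pᶠ Mx)
  holds M x        p () | nothing

  holds⁻¹ : ∀ {M x p} → Holds M x p → matchedTo M p x ≡ true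
  holds⁻¹ {M} {x} {p} h = matched h
    where
      via : ∀ {r} → M x ≡ just r → pref x r ≡ p → matchedTo M p x ≡ true
      via Mx refl rewrite Mx = postEq-refl p
      matched : Holds M x p → matchedTo M p x ≡ true
      matched (a↦p e)   = via e refl
      matched (a↦pᵗ e)  = via e refl
      matched (b↦p e)   = via e refl
      matched (b↦pᶠ e)  = via e refl
      matched (ac↦p e)  = via e refl
      matched (ac↦pᵗ e) = via e refl
      matched (bc↦p e)  = via e refl
      matched (bc↦pᶠ e) = via e refl

  not-holds : ∀ M x p → ¬ Holds M x p → matchedTo M p x ≡ false
  not-holds M x p ¬h = ¬-not (¬h ∘ holds M x p)

  aSlot bSlot : Fin m × Fin 3 → Applicant n m
  aSlot s = ac (proj₁ s) (proj₂ s)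
  bSlot s = bc (proj₁ s) (proj₂ s)

  slot∈slots : ∀ j k → (j , k) ∈ slots
  slot∈slots j k = ∈-concatMap⁺ (λ j' → map (j' ,_) (allFin 3)) (Any.map (λ { refl → ∈-map⁺ (j ,_) (∈-allFin k) }) (∈-allFin j))

  applicant∈all : ∀ x → x ∈ allApplicants
  applicant∈all (a i) = ∈-++⁺ˡ (∈-map⁺ a (∈-allFin i))
  applicant∈all (b i) = ∈-++⁺ʳ (map a (allFin n)) (∈-++⁺ˡ (∈-map⁺ b (∈-allFin i)))
  applicant∈all (ac j k) =
    ∈-++⁺ʳ (map a (allFin n)) (∈-++⁺ʳ (map b (allFin n)) (∈-++⁺ˡ (∈-map⁺ aSlot (slot∈slots j k))))
  applicant∈all (bc j k) =
    ∈-++⁺ʳ (map a (allFin n)) (∈-++⁺ʳ (map b (allFin n)) (∈-++⁺ʳ (map aSlot slots) (∈-map⁺ bSlot (slot∈slots j k))))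

  countB-all : (f : Applicant n m → Bool) → countB f allApplicants ≡
    countB (f ∘ a) (allFin n) + (countB (f ∘ b) (allFin n) + (countB (f ∘ aSlot) slots + countB (f ∘ bSlot) slots))
  countB-all f =
    trans (countB-++ f (map a (allFin n)) _) (cong₂ _+_ (countB-map a (allFin n))
    (trans (countB-++ f (map b (allFin n)) _) (cong₂ _+_ (countB-map b (allFin n))
    (trans (countB-++ f (map aSlot slots) _) (cong₂ _+_ (countB-map aSlot slots) (countB-map bSlot slots))))))
    where
      countB-map : {A : Set} (g : A → Applicant n m) (xs : List A) → countB f (map g xs) ≡ countB (f ∘ g) xs
      countB-map g []       = refl
      countB-map g (x ∷ xs) = cong (𝟙 (f (g x)) +_) (countB-map g xs)

  countB-variable-single : (f : Fin n → Bool) (i : Fin n) → (∀ i' → f i' ≡ true → i' ≡ i) → countB f (allFin n) ≡ 𝟙 (f i)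
  countB-variable-single f i only-i = begin
    countB f (allFin n)                           ≡⟨ cong (countB f) (tabulate-singletons id) ⟩
    countB f (concat (tabulate (λ i' → i' ∷ []))) ≡⟨ countB-concat-single f (λ i' → i' ∷ []) i elsewhere ⟩
    𝟙 (f i) + 0                                   ≡⟨ +-identityʳ _ ⟩
    𝟙 (f i)                                       ∎
    where
      tabulate-singletons : ∀ {k} (g : Fin k → Fin n) → tabulate g ≡ concat (tabulate (λ i' → g i' ∷ []))
      tabulate-singletons {zero}  g = refl
      tabulate-singletons {suc k} g = cong (g zero ∷_) (tabulate-singletons (g ∘ suc))
      elsewhere : ∀ i' → i' ≢ i → countB f (i' ∷ []) ≡ 0
      elsewhere i' i'≢i rewrite ¬-not {f i'} (i'≢i ∘ only-i i') = refl

  countB-clause-single : (h : Fin m × Fin 3 → Bool) (j : Fin m) → (∀ j' k → h (j' , k) ≡ true → j' ≡ j) →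
    countB h slots ≡ countB (λ k → h (j , k)) (allFin 3)
  countB-clause-single h j only-j = begin
    countB h slots                   ≡⟨ cong (countB h ∘ concat) (map-tabulate id row) ⟩
    countB h (concat (tabulate row)) ≡⟨ countB-concat-single h row j elsewhere ⟩
    countB h (row j)                 ∎
    where
      row : Fin m → List (Fin m × Fin 3)
      row j' = map (j' ,_) (allFin 3)
      elsewhere : ∀ j' → j' ≢ j → countB h (row j') ≡ 0
      elsewhere j' j'≢j = countB-none h (row j') λ where
        (j'' , k) (here refl) → ¬-not (j'≢j ∘ only-j j' k)
        (j'' , k) (there (here refl)) → ¬-not (j'≢j ∘ only-j j' k)
        (j'' , k) (there (there (here refl))) → ¬-not (j'≢j ∘ only-j j' k)

  FeasibleAt : Matching → Post n m → Set
  FeasibleAt M p = (load M p allApplicants ≤ quota p) × All (λ c → load M p (proj₁ c) ≤ proj₂ c) (classes p)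

  UnchangedAt : Matching → Matching → Post n m → Set
  UnchangedAt M M' p = ∀ x → M' x ≡ M x ⊎ matchedTo M' p x ≡ false

  -- Loads only decrease at such a post, so feasibility there is inherited.
  feasibleAt-unchanged : ∀ {M M'} p → UnchangedAt M M' p → FeasibleAt M p → FeasibleAt M' p
  feasibleAt-unchanged {M} {M'} p unchanged (bound , classBounds) =
    ≤-trans (countB-mono fewer allApplicants) bound ,
    All.map (λ {c} → ≤-trans (countB-mono fewer (proj₁ c))) classBounds
    where
      fewer : ∀ x → matchedTo M' p x ≡ true → matchedTo M p x ≡ true
      fewer x e with unchanged x
      ... | inj₁ same rewrite same = e
      ... | inj₂ gone with () ← trans (sym gone) e

  a-at-pv : ∀ {M i i'} → Holds M (a i') (pv i) → i' ≡ i
  a-at-pv (a↦p _) = refl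
  b-at-pv : ∀ {M i i'} → Holds M (b i') (pv i) → i' ≡ i
  b-at-pv (b↦p _) = refl
  a-at-pt : ∀ {M i i'} → Holds M (a i') (pt i) → i' ≡ i
  a-at-pt (a↦pᵗ _) = refl
  b-at-pf : ∀ {M i i'} → Holds M (b i') (pf i) → i' ≡ i
  b-at-pf (b↦pᶠ _) = refl
  ac-at-pc : ∀ {M j j' k} → Holds M (ac j' k) (pc j) → j' ≡ j
  ac-at-pc (ac↦p _) = refl
  bc-at-pc : ∀ {M j j' k} → Holds M (bc j' k) (pc j) → j' ≡ j
  bc-at-pc (bc↦p _) = refl
  ac-on-pt : ∀ {M i j k} → Holds M (ac j k) (pt i) → M (ac j k) ≡ second × cl j k ≡ i
  ac-on-pt (ac↦pᵗ e) = e , refl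
  bc-on-pf : ∀ {M i j k} → Holds M (bc j k) (pf i) → M (bc j k) ≡ second × cl j k ≡ i
  bc-on-pf (bc↦pᶠ e) = e , refl

  occursAs-at : ∀ {i j k} → cl j k ≡ i → occursAs i (j , k) ≡ true
  occursAs-at refl = ≟-refl _

  ac-at-pt : ∀ {M i j k} → Holds M (ac j k) (pt i) → occursAs i (j , k) ≡ true
  ac-at-pt = occursAs-at ∘ proj₂ ∘ ac-on-pt
  bc-at-pf : ∀ {M i j k} → Holds M (bc j k) (pf i) → occursAs i (j , k) ≡ true
  bc-at-pf = occursAs-at ∘ proj₂ ∘ bc-on-pf

  slot-occurs : ∀ j k → 1 ≤ occ (cl j k)
  slot-occurs j k = countB-positive (occursAs (cl j k)) slots (j , k) (slot∈slots j k) (≟-refl (cl j k))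

  module _ (M : Matching) where

    load-pv : ∀ i → load M (pv i) allApplicants ≡ load M (pv i) (a i ∷ b i ∷ [])
    load-pv i
      rewrite countB-all (matchedTo M (pv i))
            | countB-variable-single (λ i' → matchedTo M (pv i) (a i')) i (λ i' → a-at-pv ∘ holds M (a i') (pv i))
            | countB-variable-single (λ i' → matchedTo M (pv i) (b i')) i (λ i' → b-at-pv ∘ holds M (b i') (pv i))
            | countB-none (matchedTo M (pv i) ∘ aSlot) slots (λ s _ → not-holds M (aSlot s) (pv i) λ ())
            | countB-none (matchedTo M (pv i) ∘ bSlot) slots (λ s _ → not-holds M (bSlot s) (pv i) λ ())
      = refl

    load-pt : ∀ i → load M (pt i) allApplicants ≡ 𝟙 (matchedTo M (pt i) (a i)) + countB (matchedTo M (pt i) ∘ aSlot) slots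
    load-pt i
      rewrite countB-all (matchedTo M (pt i))
            | countB-variable-single (λ i' → matchedTo M (pt i) (a i')) i (λ i' → a-at-pt ∘ holds M (a i') (pt i))
            | countB-none (λ i' → matchedTo M (pt i) (b i')) (allFin n) (λ i' _ → not-holds M (b i') (pt i) λ ())
            | countB-none (matchedTo M (pt i) ∘ bSlot) slots (λ s _ → not-holds M (bSlot s) (pt i) λ ())
      = cong (𝟙 (matchedTo M (pt i) (a i)) +_) (+-identityʳ _)

    load-pf : ∀ i → load M (pf i) allApplicants ≡ 𝟙 (matchedTo M (pf i) (b i)) + countB (matchedTo M (pf i) ∘ bSlot) slots
    load-pf i
      rewrite countB-all (matchedTo M (pf i))
            | countB-variable-single (λ i' → matchedTo M (pf i) (b i')) i (λ i' → b-at-pf ∘ holds M (b i') (pf i))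
            | countB-none (λ i' → matchedTo M (pf i) (a i')) (allFin n) (λ i' _ → not-holds M (a i') (pf i) λ ())
            | countB-none (matchedTo M (pf i) ∘ aSlot) slots (λ s _ → not-holds M (aSlot s) (pf i) λ ())
      = refl

    load-pc : ∀ j → load M (pc j) allApplicants ≡
      load M (pc j) (map (ac j) (allFin 3)) + load M (pc j) (map (bc j) (allFin 3))
    load-pc j
      rewrite countB-all (matchedTo M (pc j))
            | countB-none (λ i' → matchedTo M (pc j) (a i')) (allFin n) (λ i' _ → not-holds M (a i') (pc j) λ ())
            | countB-none (λ i' → matchedTo M (pc j) (b i')) (allFin n) (λ i' _ → not-holds M (b i') (pc j) λ ())
            | countB-clause-single (matchedTo M (pc j) ∘ aSlot) j (λ j' k → ac-at-pc ∘ holds M (ac j' k) (pc j))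
            | countB-clause-single (matchedTo M (pc j) ∘ bSlot) j (λ j' k → bc-at-pc ∘ holds M (bc j' k) (pc j))
      = refl

  pv-feasible : ∀ M i → (Holds M (a i) (pv i) → Holds M (b i) (pv i) → ⊥) → FeasibleAt M (pv i)
  pv-feasible M i excl =
    subst (_≤ 1) (sym (load-pv M i)) (disjoint⇒pair≤1 _ _ λ ea eb → excl (holds M _ _ ea) (holds M _ _ eb)) , []

  pv-exclusive : ∀ M i → FeasibleAt M (pv i) → Holds M (a i) (pv i) → Holds M (b i) (pv i) → ⊥
  pv-exclusive M i (bound , _) ha hb = pair≤1⇒disjoint _ _ (subst (_≤ 1) (load-pv M i) bound) (holds⁻¹ ha) (holds⁻¹ hb)

  -- p^t_i: feasible if no a_{ij} shares it with a_i, and a_i only takes it when x_i occurs.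
  -- (The quota k_i then bounds the a_{ij}, and a_i alone fits whenever k_i ≥ 1.)
  pt-feasible : ∀ M i → (∀ j k → Holds M (ac j k) (pt i) → Holds M (a i) (pt i) → ⊥) →
    (Holds M (a i) (pt i) → 1 ≤ occ i) → FeasibleAt M (pt i)
  pt-feasible M i excl occurs = subst (_≤ occ i) (sym (load-pt M i)) total , map⁺ (All.tabulate λ {s} _ → pair s)
    where
      f : Applicant n m → Bool
      f = matchedTo M (pt i)
      pair : ∀ s → load M (pt i) (aSlot s ∷ a i ∷ []) ≤ 1
      pair (j , k) = disjoint⇒pair≤1 _ _ λ e ea → excl j k (holds M _ _ e) (holds M _ _ ea)
      total : 𝟙 (f (a i)) + countB (f ∘ aSlot) slots ≤ occ i
      total with f (a i) in ea
      ... | true  rewrite countB-none (f ∘ aSlot) slots (λ { (j , k) _ →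
                            not-holds M (ac j k) (pt i) λ h → excl j k h (holds M _ _ ea) }) = occurs (holds M _ _ ea)
      ... | false = countB-mono (λ { (j , k) e → ac-at-pt (holds M (ac j k) (pt i) e) }) slots

  pt-exclusive : ∀ M i j k → FeasibleAt M (pt i) → Holds M (ac j k) (pt i) → Holds M (a i) (pt i) → ⊥
  pt-exclusive M i j k (_ , classBounds) h ha =
    pair≤1⇒disjoint _ _ (All.lookup (map⁻ classBounds) (∈-filter⁺ (T? ∘ occursAs i) (slot∈slots j k) occurs))
      (holds⁻¹ h) (holds⁻¹ ha)
    where
      occurs : Data.Bool.T (occursAs i (j , k))
      occurs = subst Data.Bool.T (sym (ac-at-pt h)) _

  pf-feasible : ∀ M i → (∀ j k → Holds M (bc j k) (pf i) → Holds M (b i) (pf i) → ⊥) →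
    (Holds M (b i) (pf i) → 1 ≤ occ i) → FeasibleAt M (pf i)
  pf-feasible M i excl occurs = subst (_≤ occ i) (sym (load-pf M i)) total , map⁺ (All.tabulate λ {s} _ → pair s)
    where
      f : Applicant n m → Bool
      f = matchedTo M (pf i)
      pair : ∀ s → load M (pf i) (bSlot s ∷ b i ∷ []) ≤ 1
      pair (j , k) = disjoint⇒pair≤1 _ _ λ e eb → excl j k (holds M _ _ e) (holds M _ _ eb)
      total : 𝟙 (f (b i)) + countB (f ∘ bSlot) slots ≤ occ i
      total with f (b i) in eb
      ... | true  rewrite countB-none (f ∘ bSlot) slots (λ { (j , k) _ →
                            not-holds M (bc j k) (pf i) λ h → excl j k h (holds M _ _ eb) }) = occurs (holds M _ _ eb)
      ... | false = countB-mono (λ { (j , k) e → bc-at-pf (holds M (bc j k) (pf i) e) }) slots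

  pf-exclusive : ∀ M i j k → FeasibleAt M (pf i) → Holds M (bc j k) (pf i) → Holds M (b i) (pf i) → ⊥
  pf-exclusive M i j k (_ , classBounds) h hb =
    pair≤1⇒disjoint _ _ (All.lookup (map⁻ classBounds) (∈-filter⁺ (T? ∘ occursAs i) (slot∈slots j k) occurs))
      (holds⁻¹ h) (holds⁻¹ hb)
    where
      occurs : Data.Bool.T (occursAs i (j , k))
      occurs = subst Data.Bool.T (sym (bc-at-pf h)) _

  record ClauseOK (M : Matching) (j : Fin m) : Set where
    field
      slot-exclusive : ∀ k → Holds M (ac j k) (pc j) → Holds M (bc j k) (pc j) → ⊥
      a-unique       : ∀ k k' → Holds M (ac j k) (pc j) → Holds M (ac j k') (pc j) → k ≡ k'
      b-notAll       : Holds M (bc j zero) (pc j) → Holds M (bc j (suc zero)) (pc j) →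
                       Holds M (bc j (suc (suc zero))) (pc j) → ⊥

  -- These conditions characterise feasibility at p_j: they give the classes, and the quota
  -- 3 = 1 + 2 follows from the a- and b-classes ...
  pc-feasible : ∀ M j → ClauseOK M j → FeasibleAt M (pc j)
  pc-feasible M j ok =
    subst (_≤ 3) (sym (load-pc M j)) (+-mono-≤ a-class b-class) ,
    slot zero ∷ slot (suc zero) ∷ slot (suc (suc zero)) ∷ a-class ∷ b-class ∷ []
    where
      open ClauseOK ok
      f : Applicant n m → Bool
      f = matchedTo M (pc j)
      slot : ∀ k → load M (pc j) (ac j k ∷ bc j k ∷ []) ≤ 1
      slot k = disjoint⇒pair≤1 _ _ λ ea eb → slot-exclusive k (holds M _ _ ea) (holds M _ _ eb)
      a-class : countB (f ∘ ac j) (allFin 3) ≤ 1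
      a-class = atMostOne⇒count≤1 (f ∘ ac j) λ k k' e e' → a-unique k k' (holds M _ _ e) (holds M _ _ e')
      b-class : countB (f ∘ bc j) (allFin 3) ≤ 2
      b-class = notAllThree⇒count≤2 (f ∘ bc j) λ e₀ e₁ e₂ → b-notAll (holds M _ _ e₀) (holds M _ _ e₁) (holds M _ _ e₂)

  pc-ok : ∀ M j → FeasibleAt M (pc j) → ClauseOK M j
  pc-ok M j (_ , slot₀ ∷ slot₁ ∷ slot₂ ∷ a-class ∷ b-class ∷ []) = record
    { slot-exclusive = λ k h h' → pair≤1⇒disjoint _ _ (slot k) (holds⁻¹ h) (holds⁻¹ h')
    ; a-unique       = λ k k' h h' → count≤1⇒atMostOne (f ∘ ac j) a-class k k' (holds⁻¹ h) (holds⁻¹ h')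
    ; b-notAll       = λ h₀ h₁ h₂ → count≤2⇒notAllThree (f ∘ bc j) b-class (holds⁻¹ h₀) (holds⁻¹ h₁) (holds⁻¹ h₂)
    }
    where
      f : Applicant n m → Bool
      f = matchedTo M (pc j)
      slot : ∀ k → load M (pc j) (ac j k ∷ bc j k ∷ []) ≤ 1
      slot zero             = slot₀
      slot (suc zero)       = slot₁
      slot (suc (suc zero)) = slot₂

  partner : Applicant n m → Applicant n m
  partner (a i)    = b i
  partner (b i)    = a i
  partner (ac j k) = bc j k
  partner (bc j k) = ac j k

  -- Pairing up applicants with their partners permutes allApplicants.
  countB-partner : (Q : Applicant n m → Bool) → countB (Q ∘ partner) allApplicants ≡ countB Q allApplicants
  countB-partner Q = begin
    countB (Q ∘ partner) allApplicants ≡⟨ countB-all (Q ∘ partner) ⟩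
    B + (A + (BC + AC))                  ≡⟨ cong (λ t → B + (A + t)) (+-comm BC AC) ⟩
    B + (A + (AC + BC))                  ≡⟨ sym (+-assoc B A _) ⟩
    (B + A) + (AC + BC)                  ≡⟨ cong (_+ (AC + BC)) (+-comm B A) ⟩
    (A + B) + (AC + BC)                  ≡⟨ +-assoc A B _ ⟩
    A + (B + (AC + BC))                  ≡⟨ sym (countB-all Q) ⟩
    countB Q allApplicants               ∎
    where
      A B AC BC : ℕ
      A = countB (Q ∘ a) (allFin n)
      B = countB (Q ∘ b) (allFin n)
      AC = countB (Q ∘ aSlot) slots
      BC = countB (Q ∘ bSlot) slots

  Compensated : Matching → Matching → Set
  Compensated N N' = ∀ x → better (N x) (N' x) ≡ true → better (N' (partner x)) (N (partner x)) ≡ true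

  compensated-≤ : ∀ {N N'} → Compensated N N' → votes N N' ≤ votes N' N
  compensated-≤ {N} {N'} comp = ≤-trans (countB-mono comp allApplicants)
    (≤-reflexive (countB-partner (λ x → better (N' x) (N x))))

  compensated-< : ∀ {N N'} → Compensated N N' → ∀ x₀ → better (N x₀) (N' x₀) ≡ false →
    better (N' (partner x₀)) (N (partner x₀)) ≡ true → votes N N' < votes N' N
  compensated-< {N} {N'} comp x₀ noLoss gain = ≤-trans (countB-mono-< comp allApplicants x₀ (applicant∈all x₀) noLoss gain)
    (≤-reflexive (countB-partner (λ x → better (N' x) (N x))))

  better-irrefl : ∀ r → better r r ≡ false
  better-irrefl nothing = refl
  better-irrefl first   = refl
  better-irrefl second  = refl

  better-than-first : ∀ r → better r first ≡ false
  better-than-first nothing = refl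
  better-than-first first   = refl
  better-than-first second  = refl

  first-better : ∀ r → r ≢ first → better first r ≡ true
  first-better nothing _    = refl
  first-better first   r≢first = ⊥-elim (r≢first refl)
  first-better second  _    = refl

  better-than-second : ∀ r → better r second ≡ true → r ≡ first
  better-than-second first   _ = refl
  better-than-second nothing ()
  better-than-second second  ()

positive : ℕ → Bool
positive zero    = false
positive (suc _) = true

positive⇒≥1 : ∀ k → positive k ≡ true → 1 ≤ k
positive⇒≥1 (suc _) _ = s≤s z≤n

¬positive⇒≡0 : ∀ k → positive k ≡ false → k ≡ 0
¬positive⇒≡0 zero _ = refl

-- (⇐) A 1-in-3 assignment gives a popular matching.
module Backward {n m : ℕ} (cl : Fin m → Fin 3 → Fin n) where
  open Construction cl
  open Reduction cl

  holder⇒loaded : ∀ {M x p} → Holds M x p → 1 ≤ load M p allApplicants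
  holder⇒loaded {M} {x} {p} h = countB-positive (matchedTo M p) allApplicants x (applicant∈all x) (holds⁻¹ h)

  -- The matching M₀ built from an assignment τ, given a test ρ for "x_i occurs in φ":
  -- a true variable x_i sends a_i to p^t_i and b_i to p_i, its clause applicants a_{ij} to p_j and
  -- b_{ij} to p^f_i; a false one does the opposite, except that b_i is left unmatched when x_i does
  -- not occur (then p^f_i has quota 0).
  module AssignmentMatching (τ ρ : Fin n → Bool)
    (τ⇒occ : ∀ i → τ i ≡ true → 1 ≤ occ i) (ρ⇒occ : ∀ i → ρ i ≡ true → 1 ≤ occ i)
    (¬ρ⇒occ : ∀ i → ρ i ≡ false → occ i ≡ 0) (τ-oneInThree : OneInThree τ) where

    M₀ : Matching
    M₀ (a i)    = if τ i then second else first
    M₀ (b i)    = if τ i then first else (if ρ i then second else nothing)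
    M₀ (ac j k) = if τ (cl j k) then first else second
    M₀ (bc j k) = if τ (cl j k) then second else first

    τ-unique : ∀ j → AtMostOne (λ k → τ (cl j k))
    τ-unique j = count≤1⇒atMostOne (λ k → τ (cl j k)) (≤-reflexive (τ-oneInThree j))

    τ-some : ∀ j → (∀ k → τ (cl j k) ≡ false) → ⊥
    τ-some j none with τ-oneInThree j
    ... | one rewrite none zero | none (suc zero) | none (suc (suc zero)) with one
    ... | ()

    feasible₀ : Feasible M₀
    feasible₀ (pv i) = pv-feasible M₀ i excl
      where
        excl : Holds M₀ (a i) (pv i) → Holds M₀ (b i) (pv i) → ⊥
        excl (a↦p ea) (b↦p eb) with τ i | ρ i
        excl (a↦p ()) (b↦p eb) | true  | _
        excl (a↦p ea) (b↦p ()) | false | true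
        excl (a↦p ea) (b↦p ()) | false | false
    feasible₀ (pt i) = pt-feasible M₀ i excl occurs-t
      where
        excl : ∀ j k → Holds M₀ (ac j k) (pt i) → Holds M₀ (a i) (pt i) → ⊥
        excl j k (ac↦pᵗ e) (a↦pᵗ ea) with τ (cl j k)
        excl j k (ac↦pᵗ ()) (a↦pᵗ ea) | true
        excl j k (ac↦pᵗ e) (a↦pᵗ ()) | false
        occurs-t : Holds M₀ (a i) (pt i) → 1 ≤ occ i
        occurs-t (a↦pᵗ ea) with τ i in t
        ... | true = τ⇒occ i t
        occurs-t (a↦pᵗ ()) | false
    feasible₀ (pf i) = pf-feasible M₀ i excl occurs-f
      where
        excl : ∀ j k → Holds M₀ (bc j k) (pf i) → Holds M₀ (b i) (pf i) → ⊥
        excl j k (bc↦pᶠ e) (b↦pᶠ eb) with τ (cl j k)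
        excl j k (bc↦pᶠ e) (b↦pᶠ ()) | true
        excl j k (bc↦pᶠ ()) (b↦pᶠ eb) | false
        occurs-f : Holds M₀ (b i) (pf i) → 1 ≤ occ i
        occurs-f (b↦pᶠ eb) with τ i | ρ i in o
        occurs-f (b↦pᶠ ()) | true  | _
        occurs-f (b↦pᶠ eb) | false | true = ρ⇒occ i o
        occurs-f (b↦pᶠ ()) | false | false
    feasible₀ (pc j) = pc-feasible M₀ j record
      { slot-exclusive = slot-exclusive
      ; a-unique       = λ k k' h h' → τ-unique j k k' (chosen h) (chosen h')
      ; b-notAll       = λ h₀ h₁ h₂ → τ-some j λ { zero → unchosen h₀ ; (suc zero) → unchosen h₁ ; (suc (suc zero)) → unchosen h₂ }
      }
      where
        slot-exclusive : ∀ k → Holds M₀ (ac j k) (pc j) → Holds M₀ (bc j k) (pc j) → ⊥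
        slot-exclusive k (ac↦p e) (bc↦p e') with τ (cl j k)
        slot-exclusive k (ac↦p e) (bc↦p ()) | true
        slot-exclusive k (ac↦p ()) (bc↦p e') | false
        chosen : ∀ {k} → Holds M₀ (ac j k) (pc j) → τ (cl j k) ≡ true
        chosen {k} (ac↦p e) with τ (cl j k)
        chosen (ac↦p e) | true = refl
        chosen (ac↦p ()) | false
        unchosen : ∀ {k} → Holds M₀ (bc j k) (pc j) → τ (cl j k) ≡ false
        unchosen {k} (bc↦p e) with τ (cl j k)
        unchosen (bc↦p ()) | true
        unchosen (bc↦p e) | false = refl

    -- Whoever prefers a feasible M' to M₀ had a second choice in M₀ and gets a first choice in M';
    -- feasibility of M' then denies that first choice to its partner, who had it in M₀.
    popular₀ : ∀ M' → Feasible M' → ¬ MorePopular M' M₀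
    popular₀ M' F' = ≤⇒≯ (compensated-≤ {M'} {M₀} compensated)
      where
        pv-taken : ∀ i → M' (a i) ≡ first → better first (M' (b i)) ≡ true
        pv-taken i ea = first-better (M' (b i)) λ eb → pv-exclusive M' i (F' (pv i)) (a↦p ea) (b↦p eb)
        pv-taken′ : ∀ i → M' (b i) ≡ first → better first (M' (a i)) ≡ true
        pv-taken′ i eb = first-better (M' (a i)) λ ea → pv-exclusive M' i (F' (pv i)) (a↦p ea) (b↦p eb)
        pc-taken : ∀ j k → M' (ac j k) ≡ first → better first (M' (bc j k)) ≡ true
        pc-taken j k ea = first-better (M' (bc j k)) λ eb →
          ClauseOK.slot-exclusive (pc-ok M' j (F' (pc j))) k (ac↦p ea) (bc↦p eb)
        pc-taken′ : ∀ j k → M' (bc j k) ≡ first → better first (M' (ac j k)) ≡ true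
        pc-taken′ j k eb = first-better (M' (ac j k)) λ ea →
          ClauseOK.slot-exclusive (pc-ok M' j (F' (pc j))) k (ac↦p ea) (bc↦p eb)

        compensated : Compensated M' M₀
        compensated (a i) gain with τ i
        ... | true  = pv-taken i (better-than-second (M' (a i)) gain)
        ... | false with () ← trans (sym gain) (better-than-first (M' (a i)))
        compensated (b i) gain with τ i | ρ i in r | M' (b i) in eb
        ... | true  | _     | r'     with () ← trans (sym gain) (better-than-first r')
        ... | false | true  | first  = pv-taken′ i eb
        ... | false | false | first  = pv-taken′ i eb
        -- p^f_i has quota k_i = 0 when ρ i fails, so b_i cannot hold it in M'
        ... | false | false | second = ⊥-elim (1+n≰n (≤-trans (holder⇒loaded (b↦pᶠ {M'} eb))
                                                          (≤-trans (proj₁ (F' (pf i))) (≤-reflexive (¬ρ⇒occ i r)))))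
        compensated (ac j k) gain with τ (cl j k)
        ... | true  with () ← trans (sym gain) (better-than-first (M' (ac j k)))
        ... | false = pc-taken j k (better-than-second (M' (ac j k)) gain)
        compensated (bc j k) gain with τ (cl j k)
        ... | true  = pc-taken′ j k (better-than-second (M' (bc j k)) gain)
        ... | false with () ← trans (sym gain) (better-than-first (M' (bc j k)))

  popular-from-assignment : ∀ σ → OneInThree σ → ∃ PopularAmongFeasible
  popular-from-assignment σ oneInThree = M₀ , feasible₀ , popular₀
    where
      ρ τ : Fin n → Bool
      ρ i = positive (occ i)
      τ i = σ i ∧ ρ i

      τ⇒occ : ∀ i → τ i ≡ true → 1 ≤ occ i
      τ⇒occ i e with σ i
      ... | true = positive⇒≥1 (occ i) e

      -- every clause variable occurs, so τ and σ agree on clauses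
      τ-oneInThree : OneInThree τ
      τ-oneInThree j = trans (countB-cong τ≡σ (allFin 3)) (oneInThree j)
        where
          τ≡σ : ∀ k → τ (cl j k) ≡ σ (cl j k)
          τ≡σ k with occ (cl j k) | slot-occurs j k | σ (cl j k)
          ... | suc _ | _ | true  = refl
          ... | suc _ | _ | false = refl

      open AssignmentMatching τ ρ τ⇒occ (λ i → positive⇒≥1 (occ i)) (λ i → ¬positive⇒≡0 (occ i)) τ-oneInThree

-- (⇒) A popular matching gives a 1-in-3 assignment.
module Forward {n m : ℕ} (cl : Fin m → Fin 3 → Fin n) (distinct : DistinctVars cl)
  (M : Construction.Matching cl) (feasible : Construction.Feasible cl M)
  (popular : ∀ M' → Construction.Feasible cl M' → ¬ Construction.MorePopular cl M' M) where
  open Construction cl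
  open Reduction cl

  -- A feasible matching that compensates every loss relative to M and gives some applicant's
  -- partner a gain at no cost to that applicant.  It would be more popular than M.
  record Improvement : Set where
    field
      M'          : Matching
      feasible'   : Feasible M'
      compensated : Compensated M M'
      x₀          : Applicant n m
      no-loss     : better (M x₀) (M' x₀) ≡ false
      gain        : better (M' (partner x₀)) (M (partner x₀)) ≡ true

  no-improvement : Improvement → ⊥
  no-improvement I = popular M' feasible' (compensated-< {M} {M'} compensated x₀ no-loss gain)
    where open Improvement I

  pv-excl : ∀ i → M (a i) ≡ first → M (b i) ≡ first → ⊥
  pv-excl i ea eb = pv-exclusive M i (feasible (pv i)) (a↦p ea) (b↦p eb)

  slot-excl : ∀ j k → M (ac j k) ≡ first → M (bc j k) ≡ first → ⊥
  slot-excl j k ea eb = ClauseOK.slot-exclusive (pc-ok M j (feasible (pc j))) k (ac↦p ea) (bc↦p eb)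

  a-unique : ∀ j k k' → M (ac j k) ≡ first → M (ac j k') ≡ first → k ≡ k'
  a-unique j k k' ea ea' = ClauseOK.a-unique (pc-ok M j (feasible (pc j))) k k' (ac↦p ea) (ac↦p ea')

  b-notAll : ∀ j → M (bc j zero) ≡ first → M (bc j (suc zero)) ≡ first → M (bc j (suc (suc zero))) ≡ first → ⊥
  b-notAll j e₀ e₁ e₂ = ClauseOK.b-notAll (pc-ok M j (feasible (pc j))) (bc↦p e₀) (bc↦p e₁) (bc↦p e₂)

  pt-excl : ∀ j k → M (a (cl j k)) ≡ second → M (ac j k) ≡ second → ⊥
  pt-excl j k ea e = pt-exclusive M (cl j k) j k (feasible (pt (cl j k))) (ac↦pᵗ e) (a↦pᵗ ea)

  pf-excl : ∀ j k → M (b (cl j k)) ≡ second → M (bc j k) ≡ second → ⊥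
  pf-excl j k eb e = pf-exclusive M (cl j k) j k (feasible (pf (cl j k))) (bc↦pᶠ e) (b↦pᶠ eb)

  nobody-loses : ∀ {N} → (∀ x → better (M x) (N x) ≡ false) → Compensated M N
  nobody-loses noLoss x loss with () ← trans (sym loss) (noLoss x)

  -- Every variable post p_i is held by a_i or b_i: otherwise a_i could move up to it.
  module PromoteA (i : Fin n) (ha : M (a i) ≢ first) (hb : M (b i) ≢ first) where
    M' : Matching
    M' (a i')   = if ⌊ i' ≟F i ⌋ then first else M (a i')
    M' (b i')   = M (b i')
    M' (ac j k) = M (ac j k)
    M' (bc j k) = M (bc j k)

    M'-ai : M' (a i) ≡ first
    M'-ai rewrite ≟-refl i = refl

    unchanged-elsewhere : ∀ p → postEq (pv i) p ≡ false → UnchangedAt M M' p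
    unchanged-elsewhere p away (a i') with i' ≟F i
    ... | yes refl = inj₂ away
    ... | no _     = inj₁ refl
    unchanged-elsewhere p away (b i')   = inj₁ refl
    unchanged-elsewhere p away (ac j k) = inj₁ refl
    unchanged-elsewhere p away (bc j k) = inj₁ refl

    feasible' : Feasible M'
    feasible' (pv i') with i' ≟F i
    ... | yes refl = pv-feasible M' i λ { _ (b↦p eb) → hb eb }
    ... | no i'≢i  = feasibleAt-unchanged (pv i') (unchanged-elsewhere (pv i') (≟-≢ (i'≢i ∘ sym))) (feasible (pv i'))
    feasible' p@(pt _) = feasibleAt-unchanged p (unchanged-elsewhere p refl) (feasible p)
    feasible' p@(pf _) = feasibleAt-unchanged p (unchanged-elsewhere p refl) (feasible p)
    feasible' p@(pc _) = feasibleAt-unchanged p (unchanged-elsewhere p refl) (feasible p)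

    no-loss : ∀ x → better (M x) (M' x) ≡ false
    no-loss (a i') with i' ≟F i
    ... | yes refl = better-than-first (M (a i))
    ... | no _     = better-irrefl (M (a i'))
    no-loss (b i')   = better-irrefl (M (b i'))
    no-loss (ac j k) = better-irrefl (M (ac j k))
    no-loss (bc j k) = better-irrefl (M (bc j k))

    improvement : Improvement
    improvement = record
      { M' = M' ; feasible' = feasible' ; compensated = nobody-loses no-loss
      ; x₀ = b i ; no-loss = no-loss (b i)
      ; gain = subst (λ r → better r (M (a i)) ≡ true) (sym M'-ai) (first-better _ ha) }

  pv-filled : ∀ i → M (a i) ≡ first ⊎ M (b i) ≡ first
  pv-filled i with first? (M (a i)) | first? (M (b i))
  ... | inj₁ ea | _       = inj₁ ea
  ... | inj₂ _  | inj₁ eb = inj₂ eb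
  ... | inj₂ ha | inj₂ hb = ⊥-elim (no-improvement (PromoteA.improvement i ha hb))

  -- Each slot (j , k) has a_{ij} or b_{ij} on p_j.  If p_j holds no a_{ij'}, a_{ij} could move up to it;
  -- if it holds some a_{ij'}, then (as not all three b's fit) b_{ij} could move up to it.
  module PromoteSlotA (j : Fin m) (k : Fin 3) (noA : ∀ k' → M (ac j k') ≢ first) (hb : M (bc j k) ≢ first) where
    M' : Matching
    M' (a i)      = M (a i)
    M' (b i)      = M (b i)
    M' (ac j' k') = if ⌊ j' ≟F j ⌋ ∧ ⌊ k' ≟F k ⌋ then first else M (ac j' k')
    M' (bc j' k') = M (bc j' k')

    M'-here : M' (ac j k) ≡ first
    M'-here rewrite ≟-refl j | ≟-refl k = refl

    M'-other : ∀ k' → k' ≢ k → M' (ac j k') ≡ M (ac j k')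
    M'-other k' k'≢k rewrite ≟-refl j | ≟-≢ k'≢k = refl

    unchanged-elsewhere : ∀ p → postEq (pc j) p ≡ false → UnchangedAt M M' p
    unchanged-elsewhere p away (a i)      = inj₁ refl
    unchanged-elsewhere p away (b i)      = inj₁ refl
    unchanged-elsewhere p away (ac j' k') with j' ≟F j | k' ≟F k
    ... | yes refl | yes refl = inj₂ away
    ... | yes refl | no _     = inj₁ refl
    ... | no _     | _        = inj₁ refl
    unchanged-elsewhere p away (bc j' k') = inj₁ refl

    only-here : ∀ {k'} → Holds M' (ac j k') (pc j) → k' ≡ k
    only-here {k'} (ac↦p e) = by-cases (k' ≟F k)
      where
        by-cases : Dec (k' ≡ k) → k' ≡ k
        by-cases (yes k'≡k) = k'≡k
        by-cases (no k'≢k)  = ⊥-elim (noA k' (trans (sym (M'-other k' k'≢k)) e))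

    clause-ok : ClauseOK M' j
    clause-ok = record
      { slot-exclusive = λ { k' h (bc↦p eb) → hb (subst (λ k'' → M (bc j k'') ≡ first) (only-here h) eb) }
      ; a-unique       = λ k₁ k₂ h₁ h₂ → trans (only-here h₁) (sym (only-here h₂))
      ; b-notAll       = λ { (bc↦p e₀) (bc↦p e₁) (bc↦p e₂) → b-notAll j e₀ e₁ e₂ }
      }

    feasible' : Feasible M'
    feasible' p@(pv _) = feasibleAt-unchanged p (unchanged-elsewhere p refl) (feasible p)
    feasible' p@(pt _) = feasibleAt-unchanged p (unchanged-elsewhere p refl) (feasible p)
    feasible' p@(pf _) = feasibleAt-unchanged p (unchanged-elsewhere p refl) (feasible p)
    feasible' (pc j') with j' ≟F j
    ... | yes refl = pc-feasible M' j clause-ok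
    ... | no j'≢j  = feasibleAt-unchanged (pc j') (unchanged-elsewhere (pc j') (≟-≢ (j'≢j ∘ sym))) (feasible (pc j'))

    no-loss : ∀ x → better (M x) (M' x) ≡ false
    no-loss (a i)      = better-irrefl (M (a i))
    no-loss (b i)      = better-irrefl (M (b i))
    no-loss (ac j' k') with j' ≟F j | k' ≟F k
    ... | yes refl | yes refl = better-than-first (M (ac j k))
    ... | yes refl | no _     = better-irrefl (M (ac j k'))
    ... | no _     | _        = better-irrefl (M (ac j' k'))
    no-loss (bc j' k') = better-irrefl (M (bc j' k'))

    improvement : Improvement
    improvement = record
      { M' = M' ; feasible' = feasible' ; compensated = nobody-loses no-loss
      ; x₀ = bc j k ; no-loss = no-loss (bc j k)
      ; gain = subst (λ r → better r (M (ac j k)) ≡ true) (sym M'-here) (first-better _ (noA k)) }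

  module PromoteSlotB (j : Fin m) (k kA : Fin 3) (hA : M (ac j kA) ≡ first)
                      (ha : M (ac j k) ≢ first) (hb : M (bc j k) ≢ first) where
    M' : Matching
    M' (a i)      = M (a i)
    M' (b i)      = M (b i)
    M' (ac j' k') = M (ac j' k')
    M' (bc j' k') = if ⌊ j' ≟F j ⌋ ∧ ⌊ k' ≟F k ⌋ then first else M (bc j' k')

    M'-here : M' (bc j k) ≡ first
    M'-here rewrite ≟-refl j | ≟-refl k = refl

    M'-other : ∀ k' → k' ≢ k → M' (bc j k') ≡ M (bc j k')
    M'-other k' k'≢k rewrite ≟-refl j | ≟-≢ k'≢k = refl

    unchanged-elsewhere : ∀ p → postEq (pc j) p ≡ false → UnchangedAt M M' p
    unchanged-elsewhere p away (a i)      = inj₁ refl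
    unchanged-elsewhere p away (b i)      = inj₁ refl
    unchanged-elsewhere p away (ac j' k') = inj₁ refl
    unchanged-elsewhere p away (bc j' k') with j' ≟F j | k' ≟F k
    ... | yes refl | yes refl = inj₂ away
    ... | yes refl | no _     = inj₁ refl
    ... | no _     | _        = inj₁ refl

    kA≢k : kA ≢ k
    kA≢k refl = ha hA

    -- b_{ij_A} stays off p_j, because a_{ij_A} holds it
    bA-absent : Holds M' (bc j kA) (pc j) → ⊥
    bA-absent (bc↦p e) = slot-excl j kA hA (trans (sym (M'-other kA kA≢k)) e)

    slot-exclusive : ∀ k' → Holds M' (ac j k') (pc j) → Holds M' (bc j k') (pc j) → ⊥
    slot-exclusive k' (ac↦p ea) (bc↦p eb) = by-cases (k' ≟F k)
      where
        by-cases : Dec (k' ≡ k) → ⊥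
        by-cases (yes refl) = ha ea
        by-cases (no k'≢k)  = slot-excl j k' ea (trans (sym (M'-other k' k'≢k)) eb)

    clause-ok : ClauseOK M' j
    clause-ok = record
      { slot-exclusive = slot-exclusive
      ; a-unique       = λ { k₁ k₂ (ac↦p e₁) (ac↦p e₂) → a-unique j k₁ k₂ e₁ e₂ }
      ; b-notAll       = λ h₀ h₁ h₂ → bA-absent (select kA h₀ h₁ h₂)
      }
      where
        select : ∀ k' → Holds M' (bc j zero) (pc j) → Holds M' (bc j (suc zero)) (pc j) →
                 Holds M' (bc j (suc (suc zero))) (pc j) → Holds M' (bc j k') (pc j)
        select zero             h₀ _  _  = h₀
        select (suc zero)       _  h₁ _  = h₁
        select (suc (suc zero)) _  _  h₂ = h₂

    feasible' : Feasible M'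
    feasible' p@(pv _) = feasibleAt-unchanged p (unchanged-elsewhere p refl) (feasible p)
    feasible' p@(pt _) = feasibleAt-unchanged p (unchanged-elsewhere p refl) (feasible p)
    feasible' p@(pf _) = feasibleAt-unchanged p (unchanged-elsewhere p refl) (feasible p)
    feasible' (pc j') with j' ≟F j
    ... | yes refl = pc-feasible M' j clause-ok
    ... | no j'≢j  = feasibleAt-unchanged (pc j') (unchanged-elsewhere (pc j') (≟-≢ (j'≢j ∘ sym))) (feasible (pc j'))

    no-loss : ∀ x → better (M x) (M' x) ≡ false
    no-loss (a i)      = better-irrefl (M (a i))
    no-loss (b i)      = better-irrefl (M (b i))
    no-loss (ac j' k') = better-irrefl (M (ac j' k'))
    no-loss (bc j' k') with j' ≟F j | k' ≟F k
    ... | yes refl | yes refl = better-than-first (M (bc j k))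
    ... | yes refl | no _     = better-irrefl (M (bc j k'))
    ... | no _     | _        = better-irrefl (M (bc j' k'))

    improvement : Improvement
    improvement = record
      { M' = M' ; feasible' = feasible' ; compensated = nobody-loses no-loss
      ; x₀ = ac j k ; no-loss = no-loss (ac j k)
      ; gain = subst (λ r → better r (M (bc j k)) ≡ true) (sym M'-here) (first-better _ hb) }

  slot-filled : ∀ j k → M (ac j k) ≡ first ⊎ M (bc j k) ≡ first
  slot-filled j k with first? (M (ac j k)) | first? (M (bc j k))
  ... | inj₁ ea | _       = inj₁ ea
  ... | inj₂ _  | inj₁ eb = inj₂ eb
  ... | inj₂ ha | inj₂ hb with first? (M (ac j zero)) | first? (M (ac j (suc zero))) | first? (M (ac j (suc (suc zero))))
  ...   | inj₁ e | _ | _ = ⊥-elim (no-improvement (PromoteSlotB.improvement j k zero e ha hb))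
  ...   | _ | inj₁ e | _ = ⊥-elim (no-improvement (PromoteSlotB.improvement j k (suc zero) e ha hb))
  ...   | _ | _ | inj₁ e = ⊥-elim (no-improvement (PromoteSlotB.improvement j k (suc (suc zero)) e ha hb))
  ...   | inj₂ n₀ | inj₂ n₁ | inj₂ n₂ = ⊥-elim (no-improvement (PromoteSlotA.improvement j k noA hb))
    where
      noA : ∀ k' → M (ac j k') ≢ first
      noA zero             = n₀
      noA (suc zero)       = n₁
      noA (suc (suc zero)) = n₂

  dropFirst : Maybe (Fin 2) → Maybe (Fin 2)
  dropFirst first   = nothing
  dropFirst second  = second
  dropFirst nothing = nothing

  dropFirst≢first : ∀ r → dropFirst r ≢ first
  dropFirst≢first first   ()
  dropFirst≢first second  ()
  dropFirst≢first nothing ()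

  -- If a_i holds p^t_i (x_i true) for x_i = cl j k, then a_{ij} holds p_j.  It cannot share p^t_i
  -- with a_i, and were it unmatched, a_i could move up to p_i (pushing b_i off) while a_{ij}
  -- takes p^t_i: two gains against one loss.
  module RaiseTrueVariable (j : Fin m) (k : Fin 3) (ea : M (a (cl j k)) ≡ second) (unmatched : M (ac j k) ≡ nothing) where
    i : Fin n
    i = cl j k

    M' : Matching
    M' (a i')     = if ⌊ i' ≟F i ⌋ then first else M (a i')
    M' (b i')     = if ⌊ i' ≟F i ⌋ then dropFirst (M (b i')) else M (b i')
    M' (ac j' k') = if ⌊ j' ≟F j ⌋ ∧ ⌊ k' ≟F k ⌋ then second else M (ac j' k')
    M' (bc j' k') = M (bc j' k')

    M'-a : M' (a i) ≡ first
    M'-a rewrite ≟-refl i = refl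
    M'-b : M' (b i) ≡ dropFirst (M (b i))
    M'-b rewrite ≟-refl i = refl
    M'-ac : M' (ac j k) ≡ second
    M'-ac rewrite ≟-refl j | ≟-refl k = refl

    unchanged-elsewhere : ∀ p → postEq (pv i) p ≡ false → postEq (pt i) p ≡ false → UnchangedAt M M' p
    unchanged-elsewhere p away-pv away-pt (a i') with i' ≟F i
    ... | yes refl = inj₂ away-pv
    ... | no _     = inj₁ refl
    unchanged-elsewhere p away-pv away-pt (b i') with i' ≟F i
    ... | no _ = inj₁ refl
    ... | yes refl with M (b i)
    ...   | first   = inj₂ refl
    ...   | second  = inj₁ refl
    ...   | nothing = inj₁ refl
    unchanged-elsewhere p away-pv away-pt (ac j' k') with j' ≟F j | k' ≟F k
    ... | yes refl | yes refl = inj₂ away-pt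
    ... | yes refl | no _     = inj₁ refl
    ... | no _     | _        = inj₁ refl
    unchanged-elsewhere p away-pv away-pt (bc j' k') = inj₁ refl

    -- a_i now holds p_i, so it is neither on p^t_i nor sharing p_i with b_i
    a-not-second : Holds M' (a i) (pt i) → ⊥
    a-not-second (a↦pᵗ e) with () ← trans (sym M'-a) e

    feasible' : Feasible M'
    feasible' (pv i') with i' ≟F i
    ... | yes refl = pv-feasible M' i λ { _ (b↦p eb) → dropFirst≢first (M (b i)) (trans (sym M'-b) eb) }
    ... | no i'≢i  = feasibleAt-unchanged (pv i') (unchanged-elsewhere (pv i') (≟-≢ (i'≢i ∘ sym)) refl) (feasible (pv i'))
    feasible' (pt i') with i' ≟F i
    ... | yes refl = pt-feasible M' i (λ _ _ _ → a-not-second) (⊥-elim ∘ a-not-second)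
    ... | no i'≢i  = feasibleAt-unchanged (pt i') (unchanged-elsewhere (pt i') refl (≟-≢ (i'≢i ∘ sym))) (feasible (pt i'))
    feasible' p@(pf _) = feasibleAt-unchanged p (unchanged-elsewhere p refl refl) (feasible p)
    feasible' p@(pc _) = feasibleAt-unchanged p (unchanged-elsewhere p refl refl) (feasible p)

    -- only b_i can lose, and its partner a_i gains
    compensated : Compensated M M'
    compensated (a i') loss with i' ≟F i
    ... | yes refl with () ← trans (sym loss) (better-than-first (M (a i)))
    ... | no _     with () ← trans (sym loss) (better-irrefl (M (a i')))
    compensated (b i') loss with i' ≟F i
    ... | yes refl rewrite ea = refl
    ... | no _     with () ← trans (sym loss) (better-irrefl (M (b i')))
    compensated (ac j' k') loss with j' ≟F j | k' ≟F k
    ... | yes refl | yes refl rewrite unmatched with () ← loss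
    ... | yes refl | no _     with () ← trans (sym loss) (better-irrefl (M (ac j k')))
    ... | no _     | _        with () ← trans (sym loss) (better-irrefl (M (ac j' k')))
    compensated (bc j' k') loss with () ← trans (sym loss) (better-irrefl (M (bc j' k')))

    improvement : Improvement
    improvement = record
      { M' = M' ; feasible' = feasible' ; compensated = compensated
      ; x₀ = bc j k ; no-loss = better-irrefl (M (bc j k))
      ; gain = subst₂ (λ r r' → better r r' ≡ true) (sym M'-ac) (sym unmatched) refl }

  true⇒chosen : ∀ j k → M (a (cl j k)) ≡ second → M (ac j k) ≡ first
  true⇒chosen j k ea with M (ac j k) in e
  ... | first   = refl
  ... | second  = ⊥-elim (pt-excl j k ea e)
  ... | nothing = ⊥-elim (no-improvement (RaiseTrueVariable.improvement j k ea e))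

  -- a_i on p_i, b_i on p^f_i and b_{ij} unmatched: b_i moves up to p_i (pushing a_i off) and b_{ij}
  -- takes p^f_i.
  module SwapVariable (j : Fin m) (k : Fin 3) (ea : M (a (cl j k)) ≡ first) (eb : M (b (cl j k)) ≡ second)
                      (unmatched : M (bc j k) ≡ nothing) where
    i : Fin n
    i = cl j k

    M' : Matching
    M' (a i')     = if ⌊ i' ≟F i ⌋ then nothing else M (a i')
    M' (b i')     = if ⌊ i' ≟F i ⌋ then first else M (b i')
    M' (ac j' k') = M (ac j' k')
    M' (bc j' k') = if ⌊ j' ≟F j ⌋ ∧ ⌊ k' ≟F k ⌋ then second else M (bc j' k')

    M'-a : M' (a i) ≡ nothing
    M'-a rewrite ≟-refl i = refl
    M'-b : M' (b i) ≡ first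
    M'-b rewrite ≟-refl i = refl
    M'-bc : M' (bc j k) ≡ second
    M'-bc rewrite ≟-refl j | ≟-refl k = refl

    unchanged-elsewhere : ∀ p → postEq (pv i) p ≡ false → postEq (pf i) p ≡ false → UnchangedAt M M' p
    unchanged-elsewhere p away-pv away-pf (a i') with i' ≟F i
    ... | yes refl = inj₂ refl
    ... | no _     = inj₁ refl
    unchanged-elsewhere p away-pv away-pf (b i') with i' ≟F i
    ... | yes refl = inj₂ away-pv
    ... | no _     = inj₁ refl
    unchanged-elsewhere p away-pv away-pf (ac j' k') = inj₁ refl
    unchanged-elsewhere p away-pv away-pf (bc j' k') with j' ≟F j | k' ≟F k
    ... | yes refl | yes refl = inj₂ away-pf
    ... | yes refl | no _     = inj₁ refl
    ... | no _     | _        = inj₁ refl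

    b-not-second : Holds M' (b i) (pf i) → ⊥
    b-not-second (b↦pᶠ e) with () ← trans (sym M'-b) e

    feasible' : Feasible M'
    feasible' (pv i') with i' ≟F i
    ... | yes refl = pv-feasible M' i λ { (a↦p e) _ → case (trans (sym M'-a) e) }
      where case : nothing ≢ first
            case ()
    ... | no i'≢i  = feasibleAt-unchanged (pv i') (unchanged-elsewhere (pv i') (≟-≢ (i'≢i ∘ sym)) refl) (feasible (pv i'))
    feasible' (pf i') with i' ≟F i
    ... | yes refl = pf-feasible M' i (λ _ _ _ → b-not-second) (⊥-elim ∘ b-not-second)
    ... | no i'≢i  = feasibleAt-unchanged (pf i') (unchanged-elsewhere (pf i') refl (≟-≢ (i'≢i ∘ sym))) (feasible (pf i'))
    feasible' p@(pt _) = feasibleAt-unchanged p (unchanged-elsewhere p refl refl) (feasible p)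
    feasible' p@(pc _) = feasibleAt-unchanged p (unchanged-elsewhere p refl refl) (feasible p)

    -- only a_i loses, and its partner b_i gains
    compensated : Compensated M M'
    compensated (a i') loss with i' ≟F i
    ... | yes refl rewrite eb = refl
    ... | no _     with () ← trans (sym loss) (better-irrefl (M (a i')))
    compensated (b i') loss with i' ≟F i
    ... | yes refl with () ← trans (sym loss) (better-than-first (M (b i)))
    ... | no _     with () ← trans (sym loss) (better-irrefl (M (b i')))
    compensated (ac j' k') loss with () ← trans (sym loss) (better-irrefl (M (ac j' k')))
    compensated (bc j' k') loss with j' ≟F j | k' ≟F k
    ... | yes refl | yes refl rewrite unmatched with () ← loss
    ... | yes refl | no _     with () ← trans (sym loss) (better-irrefl (M (bc j k')))
    ... | no _     | _        with () ← trans (sym loss) (better-irrefl (M (bc j' k')))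

    improvement : Improvement
    improvement = record
      { M' = M' ; feasible' = feasible' ; compensated = compensated
      ; x₀ = ac j k ; no-loss = better-irrefl (M (ac j k))
      ; gain = subst₂ (λ r r' → better r r' ≡ true) (sym M'-bc) (sym unmatched) refl }

  -- a_i on p_i and b_i unmatched.  Let T be the set of slots (j , k) of x_i whose a_{ij} holds p_j.
  -- b_i takes p^f_i; for each (j , k) ∈ T, a_{ij} steps down to p^t_i and b_{ij} up to p_j, while at
  -- the next slot of C_j the a-applicant moves up to p_j and the b-applicant leaves it, so that
  -- p_j keeps one a and at most two b's.  Every loss is paired with its partner's gain, and b_i gains.
  module SecondForB (j₀ : Fin m) (k₀ : Fin 3) (ea : M (a (cl j₀ k₀)) ≡ first) (eb : M (b (cl j₀ k₀)) ≡ nothing)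
    (T : Fin m → Fin 3 → Bool)
    (T-sound : ∀ j k → T j k ≡ true → M (ac j k) ≡ first × cl j k ≡ cl j₀ k₀)
    (T-complete : ∀ j k → M (ac j k) ≡ first → cl j k ≡ cl j₀ k₀ → T j k ≡ true) where
    i : Fin n
    i = cl j₀ k₀

    M' : Matching
    M' (a i')   = M (a i')
    M' (b i')   = if ⌊ i' ≟F i ⌋ then second else M (b i')
    M' (ac j k) = if T j k then second else (if T j (prev k) then first else M (ac j k))
    M' (bc j k) = if T j k then first else (if T j (prev k) then nothing else M (bc j k))

    M'-b : M' (b i) ≡ second
    M'-b rewrite ≟-refl i = refl

    unchanged-elsewhere : ∀ p → postEq (pt i) p ≡ false → postEq (pf i) p ≡ false → (∀ j → postEq (pc j) p ≡ false) →
      UnchangedAt M M' p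
    unchanged-elsewhere p away-pt away-pf away-pc (a i') = inj₁ refl
    unchanged-elsewhere p away-pt away-pf away-pc (b i') with i' ≟F i
    ... | yes refl = inj₂ away-pf
    ... | no _     = inj₁ refl
    unchanged-elsewhere p away-pt away-pf away-pc (ac j k) with T j k in t
    ... | true = inj₂ (subst (λ i' → postEq (pt i') p ≡ false) (sym (proj₂ (T-sound j k t))) away-pt)
    ... | false with T j (prev k)
    ...   | true  = inj₂ (away-pc j)
    ...   | false = inj₁ refl
    unchanged-elsewhere p away-pt away-pf away-pc (bc j k) with T j k
    ... | true = inj₂ (away-pc j)
    ... | false with T j (prev k)
    ...   | true  = inj₂ refl
    ...   | false = inj₁ refl

    -- p^f_i: no b_{ij} is moved onto it, and those left in place are on p_j or unmatched.
    bc-never-pf : ∀ j k → Holds M' (bc j k) (pf i) → ⊥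
    bc-never-pf j k h with bc-on-pf h
    ... | e , cl≡i with T j k in t | T j (prev k)
    ...   | true  | _    with () ← e
    ...   | false | true with () ← e
    ...   | false | false with slot-filled j k
    ...     | inj₁ ea' = clash (T-complete j k ea' cl≡i) t
    ...     | inj₂ eb' with () ← trans (sym eb') e

    T-closed : ∀ j k k' → T j k ≡ true → M (ac j k') ≡ first → T j k' ≡ true
    T-closed j k k' t e = subst (λ k'' → T j k'' ≡ true) (a-unique j k k' (proj₁ (T-sound j k t)) e) t

    a-on-pc : ∀ j k → Holds M' (ac j k) (pc j) →
      (T j k ≡ false × T j (prev k) ≡ true) ⊎ (T j k ≡ false × T j (prev k) ≡ false × M (ac j k) ≡ first)
    a-on-pc j k (ac↦p e) with T j k | T j (prev k)
    ... | true  | _     with () ← e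
    ... | false | true  = inj₁ (refl , refl)
    ... | false | false = inj₂ (refl , refl , e)

    b-on-pc : ∀ j k → Holds M' (bc j k) (pc j) →
      T j k ≡ true ⊎ (T j k ≡ false × T j (prev k) ≡ false × M (bc j k) ≡ first)
    b-on-pc j k (bc↦p e) with T j k | T j (prev k)
    ... | true  | _     = inj₁ refl
    ... | false | true  with () ← e
    ... | false | false = inj₂ (refl , refl , e)

    clause-ok : ∀ j → ClauseOK M' j
    clause-ok j = record { slot-exclusive = slot-exclusive ; a-unique = unique ; b-notAll = notAll }
      where
        slot-exclusive : ∀ k → Holds M' (ac j k) (pc j) → Holds M' (bc j k) (pc j) → ⊥
        slot-exclusive k h h' with a-on-pc j k h | b-on-pc j k h'
        ... | inj₁ (t , _)     | inj₁ t'            = clash t' t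
        ... | inj₂ (t , _)     | inj₁ t'            = clash t' t
        ... | inj₁ (_ , tp)    | inj₂ (_ , tp' , _) = clash tp tp'
        ... | inj₂ (_ , _ , e) | inj₂ (_ , _ , e')  = slot-excl j k e e'

        -- an a moved up to p_j sits right after a slot of T, whose a-applicant held p_j before
        unique : ∀ k k' → Holds M' (ac j k) (pc j) → Holds M' (ac j k') (pc j) → k ≡ k'
        unique k k' h h' with a-on-pc j k h | a-on-pc j k' h'
        ... | inj₁ (_ , tp) | inj₁ (_ , tp') =
          prev-injective (a-unique j (prev k) (prev k') (proj₁ (T-sound j (prev k) tp)) (proj₁ (T-sound j (prev k') tp')))
        ... | inj₁ (_ , tp) | inj₂ (t' , _ , e') = ⊥-elim (clash (T-closed j (prev k) k' tp e') t')
        ... | inj₂ (t , _ , e) | inj₁ (_ , tp') = ⊥-elim (clash (T-closed j (prev k') k tp' e) t)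
        ... | inj₂ (_ , _ , e) | inj₂ (_ , _ , e') = a-unique j k k' e e'

        gap-after : ∀ k → T j k ≡ true → Holds M' (bc j (next k)) (pc j) → ⊥
        gap-after k t h with b-on-pc j (next k) h
        ... | inj₁ t' = prev-≢ (next k) (trans (prev-next k)
                          (a-unique j k (next k) (proj₁ (T-sound j k t)) (proj₁ (T-sound j (next k) t'))))
        ... | inj₂ (_ , tp , _) = clash t (subst (λ k'' → T j k'' ≡ false) (prev-next k) tp)

        notAll : Holds M' (bc j zero) (pc j) → Holds M' (bc j (suc zero)) (pc j) → Holds M' (bc j (suc (suc zero))) (pc j) → ⊥
        notAll h₀ h₁ h₂ with b-on-pc j zero h₀ | b-on-pc j (suc zero) h₁ | b-on-pc j (suc (suc zero)) h₂
        ... | inj₁ t | _ | _ = gap-after zero t h₁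
        ... | _ | inj₁ t | _ = gap-after (suc zero) t h₂
        ... | _ | _ | inj₁ t = gap-after (suc (suc zero)) t h₀
        ... | inj₂ (_ , _ , e₀) | inj₂ (_ , _ , e₁) | inj₂ (_ , _ , e₂) = b-notAll j e₀ e₁ e₂

    feasible' : Feasible M'
    feasible' (pv i') = feasibleAt-unchanged (pv i') (unchanged-elsewhere (pv i') refl refl (λ _ → refl)) (feasible (pv i'))
    feasible' (pt i') with i ≟F i'
    ... | yes refl = pt-feasible M' i (λ { _ _ _ (a↦pᵗ e) → a-first e }) (λ { (a↦pᵗ e) → ⊥-elim (a-first e) })
      where a-first : M (a i) ≢ second
            a-first e with () ← trans (sym ea) e
    ... | no i≢i'  = feasibleAt-unchanged (pt i') (unchanged-elsewhere (pt i') (≟-≢ i≢i') refl (λ _ → refl)) (feasible (pt i'))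
    feasible' (pf i') with i ≟F i'
    ... | yes refl = pf-feasible M' i (λ j k h _ → bc-never-pf j k h) (λ _ → slot-occurs j₀ k₀)
    ... | no i≢i'  = feasibleAt-unchanged (pf i') (unchanged-elsewhere (pf i') refl (≟-≢ i≢i') (λ _ → refl)) (feasible (pf i'))
    feasible' (pc j) = pc-feasible M' j (clause-ok j)

    -- a_{ij} of a slot in T loses while b_{ij} gains; the b-applicant after it may lose while its
    -- partner gains p_j.
    compensated : Compensated M M'
    compensated (a i') loss with () ← trans (sym loss) (better-irrefl (M (a i')))
    compensated (b i') loss with i' ≟F i
    ... | yes refl rewrite eb with () ← loss
    ... | no _     with () ← trans (sym loss) (better-irrefl (M (b i')))
    compensated (ac j k) loss with T j k in t
    ... | true = first-better _ λ e → slot-excl j k (proj₁ (T-sound j k t)) e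
    ... | false with T j (prev k)
    ...   | true  with () ← trans (sym loss) (better-than-first (M (ac j k)))
    ...   | false with () ← trans (sym loss) (better-irrefl (M (ac j k)))
    compensated (bc j k) loss with T j k
    ... | true with () ← trans (sym loss) (better-than-first (M (bc j k)))
    ... | false with T j (prev k) in tp
    ...   | true  = first-better _ λ e → prev-≢ k (a-unique j (prev k) k (proj₁ (T-sound j (prev k) tp)) e)
    ...   | false with () ← trans (sym loss) (better-irrefl (M (bc j k)))

    improvement : Improvement
    improvement = record
      { M' = M' ; feasible' = feasible' ; compensated = compensated
      ; x₀ = a i ; no-loss = better-irrefl (M (a i))
      ; gain = subst₂ (λ r r' → better r r' ≡ true) (sym M'-b) (sym eb) refl }

  -- a_i unmatched and b_i on p_i.  Let F be the set of slots (j , k) of x_i whose b_{ij} holds p_j, and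
  -- G the set of slots whose a-applicant holds a clause post p_j with j in F.  a_i takes p^t_i; for
  -- (j , k) ∈ F, b_{ij} steps down to p^f_i and a_{ij} up to p_j, while the a-applicant that held p_j
  -- (in G) leaves it and its partner moves up.  Distinct variables per clause keep one a on p_j.
  module SecondForA (j₀ : Fin m) (k₀ : Fin 3) (ea : M (a (cl j₀ k₀)) ≡ nothing) (eb : M (b (cl j₀ k₀)) ≡ first)
    (F G : Fin m → Fin 3 → Bool)
    (F-sound : ∀ j k → F j k ≡ true → M (bc j k) ≡ first × cl j k ≡ cl j₀ k₀)
    (F-complete : ∀ j k → M (bc j k) ≡ first → cl j k ≡ cl j₀ k₀ → F j k ≡ true)
    (G-sound : ∀ j k → G j k ≡ true → M (ac j k) ≡ first × ∃ (λ k' → F j k' ≡ true))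
    (G-complete : ∀ j k k' → M (ac j k) ≡ first → F j k' ≡ true → G j k ≡ true) where
    i : Fin n
    i = cl j₀ k₀

    M' : Matching
    M' (a i')   = if ⌊ i' ≟F i ⌋ then second else M (a i')
    M' (b i')   = M (b i')
    M' (ac j k) = if F j k then first else (if G j k then nothing else M (ac j k))
    M' (bc j k) = if F j k then second else (if G j k then first else M (bc j k))

    M'-a : M' (a i) ≡ second
    M'-a rewrite ≟-refl i = refl

    unchanged-elsewhere : ∀ p → postEq (pt i) p ≡ false → postEq (pf i) p ≡ false → (∀ j → postEq (pc j) p ≡ false) →
      UnchangedAt M M' p
    unchanged-elsewhere p away-pt away-pf away-pc (a i') with i' ≟F i
    ... | yes refl = inj₂ away-pt
    ... | no _     = inj₁ refl
    unchanged-elsewhere p away-pt away-pf away-pc (b i') = inj₁ refl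
    unchanged-elsewhere p away-pt away-pf away-pc (ac j k) with F j k
    ... | true = inj₂ (away-pc j)
    ... | false with G j k
    ...   | true  = inj₂ refl
    ...   | false = inj₁ refl
    unchanged-elsewhere p away-pt away-pf away-pc (bc j k) with F j k in f
    ... | true = inj₂ (subst (λ i' → postEq (pf i') p ≡ false) (sym (proj₂ (F-sound j k f))) away-pf)
    ... | false with G j k
    ...   | true  = inj₂ (away-pc j)
    ...   | false = inj₁ refl

    -- p^t_i: no a_{ij} is moved onto it, and those left in place are on p_j or unmatched.
    ac-never-pt : ∀ j k → Holds M' (ac j k) (pt i) → ⊥
    ac-never-pt j k h with ac-on-pt h
    ... | e , cl≡i with F j k in f | G j k
    ...   | true  | _     with () ← e
    ...   | false | true  with () ← e
    ...   | false | false with slot-filled j k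
    ...     | inj₁ ea' with () ← trans (sym ea') e
    ...     | inj₂ eb' = clash (F-complete j k eb' cl≡i) f

    a-on-pc : ∀ j k → Holds M' (ac j k) (pc j) →
      F j k ≡ true ⊎ (F j k ≡ false × G j k ≡ false × M (ac j k) ≡ first)
    a-on-pc j k (ac↦p e) with F j k | G j k
    ... | true  | _     = inj₁ refl
    ... | false | true  with () ← e
    ... | false | false = inj₂ (refl , refl , e)

    b-on-pc : ∀ j k → Holds M' (bc j k) (pc j) →
      (F j k ≡ false × G j k ≡ true) ⊎ (F j k ≡ false × G j k ≡ false × M (bc j k) ≡ first)
    b-on-pc j k (bc↦p e) with F j k | G j k
    ... | true  | _     with () ← e
    ... | false | true  = inj₁ (refl , refl)
    ... | false | false = inj₂ (refl , refl , e)

    clause-ok : ∀ j → ClauseOK M' j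
    clause-ok j = record { slot-exclusive = slot-exclusive ; a-unique = unique ; b-notAll = notAll }
      where
        slot-exclusive : ∀ k → Holds M' (ac j k) (pc j) → Holds M' (bc j k) (pc j) → ⊥
        slot-exclusive k h h' with a-on-pc j k h | b-on-pc j k h'
        ... | inj₁ f           | inj₁ (f' , _)     = clash f f'
        ... | inj₁ f           | inj₂ (f' , _)     = clash f f'
        ... | inj₂ (_ , g , _) | inj₁ (_ , g')     = clash g' g
        ... | inj₂ (_ , _ , e) | inj₂ (_ , _ , e') = slot-excl j k e e'

        -- two slots of F in one clause carry the same variable, hence coincide
        unique : ∀ k k' → Holds M' (ac j k) (pc j) → Holds M' (ac j k') (pc j) → k ≡ k'
        unique k k' h h' with a-on-pc j k h | a-on-pc j k' h'
        ... | inj₁ f | inj₁ f' = distinct j k k' (trans (proj₂ (F-sound j k f)) (sym (proj₂ (F-sound j k' f'))))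
        ... | inj₁ f | inj₂ (_ , g' , e') = ⊥-elim (clash (G-complete j k' k e' f) g')
        ... | inj₂ (_ , g , e) | inj₁ f' = ⊥-elim (clash (G-complete j k k' e f') g)
        ... | inj₂ (_ , _ , e) | inj₂ (_ , _ , e') = a-unique j k k' e e'

        -- the b-applicant of a slot of F has left p_j (for p^f_i)
        gap-at : ∀ k → G j k ≡ true → Holds M' (bc j zero) (pc j) → Holds M' (bc j (suc zero)) (pc j) →
                 Holds M' (bc j (suc (suc zero))) (pc j) → ⊥
        gap-at k g h₀ h₁ h₂ with G-sound j k g
        ... | _ , (kf , f) with b-on-pc j kf (select kf)
          where
            select : ∀ k' → Holds M' (bc j k') (pc j)
            select zero             = h₀
            select (suc zero)       = h₁
            select (suc (suc zero)) = h₂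
        ...   | inj₁ (f' , _) = clash f f'
        ...   | inj₂ (f' , _) = clash f f'

        notAll : Holds M' (bc j zero) (pc j) → Holds M' (bc j (suc zero)) (pc j) → Holds M' (bc j (suc (suc zero))) (pc j) → ⊥
        notAll h₀ h₁ h₂ with b-on-pc j zero h₀ | b-on-pc j (suc zero) h₁ | b-on-pc j (suc (suc zero)) h₂
        ... | inj₁ (_ , g) | _ | _ = gap-at zero g h₀ h₁ h₂
        ... | _ | inj₁ (_ , g) | _ = gap-at (suc zero) g h₀ h₁ h₂
        ... | _ | _ | inj₁ (_ , g) = gap-at (suc (suc zero)) g h₀ h₁ h₂
        ... | inj₂ (_ , _ , e₀) | inj₂ (_ , _ , e₁) | inj₂ (_ , _ , e₂) = b-notAll j e₀ e₁ e₂

    feasible' : Feasible M'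
    feasible' (pv i') = feasibleAt-unchanged (pv i') (unchanged-elsewhere (pv i') refl refl (λ _ → refl)) (feasible (pv i'))
    feasible' (pt i') with i ≟F i'
    ... | yes refl = pt-feasible M' i (λ j k h _ → ac-never-pt j k h) (λ _ → slot-occurs j₀ k₀)
    ... | no i≢i'  = feasibleAt-unchanged (pt i') (unchanged-elsewhere (pt i') (≟-≢ i≢i') refl (λ _ → refl)) (feasible (pt i'))
    feasible' (pf i') with i ≟F i'
    ... | yes refl = pf-feasible M' i (λ { _ _ _ (b↦pᶠ e) → b-first e }) (λ { (b↦pᶠ e) → ⊥-elim (b-first e) })
      where b-first : M (b i) ≢ second
            b-first e with () ← trans (sym eb) e
    ... | no i≢i'  = feasibleAt-unchanged (pf i') (unchanged-elsewhere (pf i') refl (≟-≢ i≢i') (λ _ → refl)) (feasible (pf i'))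
    feasible' (pc j) = pc-feasible M' j (clause-ok j)

    -- b_{ij} of a slot in F loses while a_{ij} gains; an a-applicant leaving p_j loses while its
    -- partner gains p_j.
    compensated : Compensated M M'
    compensated (a i') loss with i' ≟F i
    ... | yes refl rewrite ea with () ← loss
    ... | no _     with () ← trans (sym loss) (better-irrefl (M (a i')))
    compensated (b i') loss with () ← trans (sym loss) (better-irrefl (M (b i')))
    compensated (ac j k) loss with F j k
    ... | true with () ← trans (sym loss) (better-than-first (M (ac j k)))
    ... | false with G j k in g
    ...   | true  = first-better _ λ e → slot-excl j k (proj₁ (G-sound j k g)) e
    ...   | false with () ← trans (sym loss) (better-irrefl (M (ac j k)))
    compensated (bc j k) loss with F j k in f
    ... | true = first-better _ λ e → slot-excl j k e (proj₁ (F-sound j k f))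
    ... | false with G j k
    ...   | true  with () ← trans (sym loss) (better-than-first (M (bc j k)))
    ...   | false with () ← trans (sym loss) (better-irrefl (M (bc j k)))

    improvement : Improvement
    improvement = record
      { M' = M' ; feasible' = feasible' ; compensated = compensated
      ; x₀ = b i ; no-loss = better-irrefl (M (b i))
      ; gain = subst₂ (λ r r' → better r r' ≡ true) (sym M'-a) (sym ea) refl }

  module OccurrenceSets (i : Fin n) where
    T F G : Fin m → Fin 3 → Bool
    T j k = isFirst (M (ac j k)) ∧ ⌊ cl j k ≟F i ⌋
    F j k = isFirst (M (bc j k)) ∧ ⌊ cl j k ≟F i ⌋
    G j k = isFirst (M (ac j k)) ∧ some (F j)

    T-sound : ∀ j k → T j k ≡ true → M (ac j k) ≡ first × cl j k ≡ i
    T-sound j k t with ∧-split {isFirst (M (ac j k))} t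
    ... | e , e' = isFirst-sound _ e , ≟-sound e'

    T-complete : ∀ j k → M (ac j k) ≡ first → cl j k ≡ i → T j k ≡ true
    T-complete j k e refl rewrite e = ≟-refl (cl j k)

    F-sound : ∀ j k → F j k ≡ true → M (bc j k) ≡ first × cl j k ≡ i
    F-sound j k f with ∧-split {isFirst (M (bc j k))} f
    ... | e , e' = isFirst-sound _ e , ≟-sound e'

    F-complete : ∀ j k → M (bc j k) ≡ first → cl j k ≡ i → F j k ≡ true
    F-complete j k e refl rewrite e = ≟-refl (cl j k)

    G-sound : ∀ j k → G j k ≡ true → M (ac j k) ≡ first × ∃ (λ k' → F j k' ≡ true)
    G-sound j k g with ∧-split {isFirst (M (ac j k))} g
    ... | e , e' = isFirst-sound _ e , some-sound (F j) e'

    G-complete : ∀ j k k' → M (ac j k) ≡ first → F j k' ≡ true → G j k ≡ true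
    G-complete j k k' e f rewrite e = some-complete (F j) k' f

  -- If a_{ij} holds p_j then a_i holds p^t_i: every other state of (a_i , b_i) is ruled out by
  -- feasibility, by pv-filled, or by one of the improvements SwapVariable, SecondForB, SecondForA.
  chosen⇒true : ∀ j k → M (ac j k) ≡ first → M (a (cl j k)) ≡ second
  chosen⇒true j k e with M (a (cl j k)) in ea | M (b (cl j k)) in eb
  ... | second  | _      = refl
  ... | first   | first  = ⊥-elim (pv-excl (cl j k) ea eb)
  ... | first   | second = ⊥-elim (no-improvement (SwapVariable.improvement j k ea eb b-unmatched))
    where
      b-unmatched : M (bc j k) ≡ nothing
      b-unmatched with M (bc j k) in e'
      ... | first   = ⊥-elim (slot-excl j k e e')
      ... | second  = ⊥-elim (pf-excl j k eb e')
      ... | nothing = refl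
  ... | first   | nothing = ⊥-elim (no-improvement (SecondForB.improvement j k ea eb T T-sound T-complete))
    where open OccurrenceSets (cl j k)
  ... | nothing | first   = ⊥-elim (no-improvement
                              (SecondForA.improvement j k ea eb F G F-sound F-complete G-sound G-complete))
    where open OccurrenceSets (cl j k)
  ... | nothing | second  with pv-filled (cl j k)
  ...   | inj₁ ea' with () ← trans (sym ea) ea'
  ...   | inj₂ eb' with () ← trans (sym eb) eb'
  chosen⇒true j k e | nothing | nothing with pv-filled (cl j k)
  ...   | inj₁ ea' with () ← trans (sym ea) ea'
  ...   | inj₂ eb' with () ← trans (sym eb) eb'

  -- Each clause post holds exactly one a-applicant: at most one by its class, and at least one
  -- since every slot is filled and not all three b's fit.
  some-chosen : ∀ j → ∃ λ k → M (ac j k) ≡ first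
  some-chosen j with first? (M (ac j zero)) | first? (M (ac j (suc zero))) | first? (M (ac j (suc (suc zero))))
  ... | inj₁ e  | _       | _       = zero , e
  ... | inj₂ _  | inj₁ e  | _       = suc zero , e
  ... | inj₂ _  | inj₂ _  | inj₁ e  = suc (suc zero) , e
  ... | inj₂ n₀ | inj₂ n₁ | inj₂ n₂ = ⊥-elim (b-notAll j (b-first n₀) (b-first n₁) (b-first n₂))
    where
      b-first : ∀ {k} → M (ac j k) ≢ first → M (bc j k) ≡ first
      b-first {k} ¬ea with slot-filled j k
      ... | inj₁ ea = ⊥-elim (¬ea ea)
      ... | inj₂ eb = eb

  -- The assignment read off M: x_i is true when a_i holds p^t_i.
  σ : Fin n → Bool
  σ i = isSecond (M (a i))

  σ-chosen : ∀ j k → σ (cl j k) ≡ isFirst (M (ac j k))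
  σ-chosen j k with first? (M (ac j k))
  ... | inj₁ e rewrite e | chosen⇒true j k e = refl
  ... | inj₂ ¬e with M (a (cl j k)) in ea
  ...   | second  = ⊥-elim (¬e (true⇒chosen j k ea))
  ...   | first   = sym (isFirst-≢ ¬e)
  ...   | nothing = sym (isFirst-≢ ¬e)

  oneInThree : OneInThree σ
  oneInThree j with some-chosen j
  ... | k , e = trans (countB-cong (σ-chosen j) (allFin 3))
                      (exactlyOne (λ k' → isFirst (M (ac j k'))) unique k (subst (λ r → isFirst r ≡ true) (sym e) refl))
    where
      unique : AtMostOne (λ k' → isFirst (M (ac j k')))
      unique k₁ k₂ e₁ e₂ = a-unique j k₁ k₂ (isFirst-sound _ e₁) (isFirst-sound _ e₂)

theorem6 : (n m : ℕ) (cl : Fin m → Fin 3 → Fin n) → DistinctVars cl →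
    (∃ λ M → Construction.PopularAmongFeasible cl M) ⇔ (∃ λ σ → Construction.OneInThree cl σ)
theorem6 n m cl distinct = mk⇔ assignment-from-popular matching-from-assignment
  where
    assignment-from-popular : (∃ λ M → Construction.PopularAmongFeasible cl M) → (∃ λ σ → Construction.OneInThree cl σ)
    assignment-from-popular (M , feasible , popular) = σ , oneInThree
      where open Forward cl distinct M feasible popular

    matching-from-assignment : (∃ λ σ → Construction.OneInThree cl σ) → (∃ λ M → Construction.PopularAmongFeasible cl M)
    matching-from-assignment (σ , oneInThree) = Backward.popular-from-assignment cl σ oneInThree
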